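{- We have $|\mathcal{M}(1)/\!\sim_{cr,2}|=1$ and $|\mathcal{M}(n)/\!\sim_{cr,2}|=2$ for $n\ge 2$; for $n\ge 2$ the two classes of $\sim_{cr,2}$ have $((2n-1)!!+1)/2$ and $((2n-1)!!-1)/2$ elements. Moreover $|\mathcal{M}(1)/\!\sim_{ne,2}|=1$, $|\mathcal{M}(2)/\!\sim_{ne,2}|=3$, and $|\mathcal{M}(n)/\!\sim_{ne,2}|=2n$ for $n\ge 3$.
   Context: A matching on $[2n]$ is a partition of $[2n]$ into $n$ two-element blocks (edges); $\mathcal{M}(n)$ is the set of such matchings, of cardinality $(2n-1)!!=1\cdot3\cdots(2n-1)$. Edges $A,B$ cross if $\min A<\min B<\max A<\max B$ or vice versa, and are nested if $\min A<\min B<\max B<\max A$ or vice versa; $cr(M),ne(M)$ count crossing and nested pairs, and $cr_2(M),ne_2(M)\in\{0,1\}$ are their residues mod 2. For $M\in\mathcal{M}(m)$, its children are the matchings obtained by choosing $x\in\{2,\dots,2m+2\}$, relabeling the vertices of $M$ order-preservingly by $\{2,\dots,2m+2\}\setminus\{x\}$ and adding the edge $\{1,x\}$. $\mathcal{T}(M,0)=\{M\}$ and $\mathcal{T}(M,l+1)$ is the set of children of members of $\mathcal{T}(M,l)$. $M\sim_{cr,2}N$ means the multisets $\{cr_2(P):P\in\mathcal{T}(M,l)\}$ and $\{cr_2(P):P\in\mathcal{T}(N,l)\}$ coincide for every $l\ge 0$; $\sim_{ne,2}$ is defined likewise with $ne_2$. -}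

module Defs where

open import Data.Nat using (ℕ; zero; suc; _+_; _*_; _∸_; _≤_; _<ᵇ_; _%_)
open import Data.Bool using (Bool; true; false; if_then_else_; _∧_)
open import Data.List using (List; []; _∷_; map; length; concatMap; upTo)
open import Data.Nat.ListAction using (sum)
open import Data.Product using (_×_; _,_; Σ; ∃; ∃-syntax; proj₁; proj₂)
open import Data.Sum using (_⊎_)
open import Data.List.Relation.Unary.Any using (Any)
open import Data.List.Relation.Unary.AllPairs using (AllPairs)
open import Data.List.Relation.Unary.Unique.Propositional using (Unique)
open import Data.List.Membership.Propositional using (_∈_)
open import Data.List.Relation.Binary.Permutation.Propositional using (_↭_)
open import Relation.Binary.PropositionalEquality using (_≡_; _≢_)
open import Relation.Nullary using (¬_)

-- A matching on [2n] = {1,…,2n} is encoded by its partner list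
-- v = (v₁,…,v₂ₙ) : vᵢ is the vertex matched with i (1-based vertices).

Matching : Set
Matching = List ℕ

-- 1-based lookup (value 0 outside the range; never used inside it)
at : List ℕ → ℕ → ℕ
at []       _             = 0
at (x ∷ xs) 0             = 0
at (x ∷ xs) 1             = x
at (x ∷ xs) (suc (suc i)) = at xs (suc i)

IsMatching : ℕ → Matching → Set
IsMatching n v =
  length v ≡ 2 * n ×
  (∀ i → 1 ≤ i → i ≤ 2 * n →
     1 ≤ at v i × at v i ≤ 2 * n × at v i ≢ i × at v (at v i) ≡ i)

edgesFrom : ℕ → List ℕ → List (ℕ × ℕ)
edgesFrom i []       = []
edgesFrom i (p ∷ ps) =
  if i <ᵇ p then (i , p) ∷ edgesFrom (suc i) ps else edgesFrom (suc i) ps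

edges : Matching → List (ℕ × ℕ)
edges v = edgesFrom 1 v

-- A = (a , a'), B = (b , b') with a < a', b < b'.
-- crossesᵇ A B : a < b < a' < b'     (each crossing pair counted once)
-- nestsᵇ   A B : a < b < b' < a'     (each nested pair counted once)
crossesᵇ : ℕ × ℕ → ℕ × ℕ → Bool
crossesᵇ (a , a') (b , b') = (a <ᵇ b) ∧ ((b <ᵇ a') ∧ (a' <ᵇ b'))

nestsᵇ : ℕ × ℕ → ℕ × ℕ → Bool
nestsᵇ (a , a') (b , b') = (a <ᵇ b) ∧ ((b <ᵇ b') ∧ (b' <ᵇ a'))

countPairs : (ℕ × ℕ → ℕ × ℕ → Bool) → List (ℕ × ℕ) → ℕ
countPairs r es = sum (map (λ A → sum (map (λ B → if r A B then 1 else 0) es)) es)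

cr ne cr₂ ne₂ : Matching → ℕ
cr v  = countPairs crossesᵇ (edges v)
ne v  = countPairs nestsᵇ (edges v)
cr₂ v = cr v % 2
ne₂ v = ne v % 2

-- order-preserving relabelling [2m] → {2,…,2m+2} ∖ {x}
relabel : ℕ → ℕ → ℕ
relabel x i = if (i + 1) <ᵇ x then i + 1 else i + 2

insertAt : ℕ → ℕ → List ℕ → List ℕ
insertAt zero    a xs       = a ∷ xs
insertAt (suc k) a []       = a ∷ []
insertAt (suc k) a (y ∷ ys) = y ∷ insertAt k a ys

-- child of v obtained by adding the edge {1 , x}:
-- vertex 1 has partner x; position x (index x-2 in the tail) has partner 1;
-- every other position relabel(i) has partner relabel(vᵢ).
child : Matching → ℕ → Matching
child v x = x ∷ insertAt (x ∸ 2) 1 (map (relabel x) v)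

children : Matching → List Matching
children v = map (λ k → child v (2 + k)) (upTo (suc (length v)))

tree : Matching → ℕ → List Matching
tree M zero    = M ∷ []
tree M (suc l) = concatMap children (tree M l)

-- The equivalence: multisets of statistic values on 𝓣(M,l), 𝓣(N,l)
-- coincide for all l (multiset equality = list permutation).

_∼[_]_ : Matching → (Matching → ℕ) → Matching → Set
M ∼[ s ] N = ∀ l → map s (tree M l) ↭ map s (tree N l)

-- |𝓜(n) / ∼[ s ]| = k : there is a list of k matchings in 𝓜(n),
-- pairwise inequivalent, such that every matching of 𝓜(n) is equivalent
-- to one of them (a system of class representatives).
NumClasses : (Matching → ℕ) → ℕ → ℕ → Set
NumClasses s n k =
  Σ (List Matching) λ reps →
    length reps ≡ k ×
    (∀ {M} → M ∈ reps → IsMatching n M) ×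
    AllPairs (λ M N → ¬ (M ∼[ s ] N)) reps ×
    (∀ N → IsMatching n N → Any (λ M → N ∼[ s ] M) reps)

ClassSize : (Matching → ℕ) → ℕ → Matching → ℕ → Set
ClassSize s n M k =
  Σ (List Matching) λ L →
    Unique L ×
    length L ≡ k ×
    (∀ N → (N ∈ L → IsMatching n N × N ∼[ s ] M) ×
           (IsMatching n N × N ∼[ s ] M → N ∈ L))

-- (2n-1)!! = 1·3·⋯·(2n-1)
_!! : ℕ → ℕ
zero !!  = 1
suc n !! = (2 * n + 1) * (n !!)

-- Adding the edge {1, k + 2} to a matching v adds to cr the number of edges
-- of v met by the gap after vertex k, which has the parity of k, and adds to
-- ne the number A k of edges of v closed by vertex k.  Hence the signed sum
-- of (-1)^cr over 𝓣(M, l) is (-1)^(cr M) for every l, and the signed sum of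
-- (-1)^ne over 𝓣(M, l + 1) is (-1)^(ne M) ∑ₖ (-1)^(A k), an identity that
-- propagates down the tree.  As a multiset of parities is determined by its
-- size and its signed sum, M ∼cr N iff cr₂ M = cr₂ N, and M ∼ne N iff ne₂ and
-- the number of odd values of A agree.  For n ≥ 3 the latter number takes
-- exactly n values, each together with both parities of ne, while the
-- signed crossing sum 1 over 𝓜(n) gives the two cr class sizes.

module Submission where

open import Defs
open import Algebra.Properties.CommutativeSemigroup using (interchange)
open import Data.Bool using (Bool; true; false; not; _∧_; if_then_else_; T)
open import Data.Bool.Properties using (not-involutive)
open import Data.Empty using (⊥-elim)
open import Data.Fin as Fin using (Fin; toℕ; fromℕ<)
open import Data.Fin.Properties using (toℕ-injective; toℕ-fromℕ<; toℕ<n)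
open import Data.Integer as ℤ using (ℤ; -_; 0ℤ; 1ℤ; -1ℤ)
import Data.Integer.Properties as ℤ
open import Data.Integer.Solver using (module +-*-Solver)
open import Data.List
  using (List; []; _∷_; _++_; map; length; concatMap; upTo; applyUpTo; filter; replicate; allFin; cartesianProduct)
open import Data.List.Membership.Propositional using (_∈_; find)
open import Data.List.Membership.Propositional.Properties
  using (∈-concatMap⁺; ∈-concatMap⁻; ∈-map⁺; ∈-map⁻; ∈-upTo⁺; ∈-upTo⁻; ∈-allFin; ∈-filter⁺; ∈-filter⁻; ∈-cartesianProduct⁺)
open import Data.List.Properties
  using (≡-dec; ∷-injectiveˡ; ∷-injectiveʳ; map-injective; map-∘; map-cong; map-cong-local; length-map; length-++;
         length-applyUpTo; length-tabulate; ++-identityʳ; concatMap-++; concatMap-pure; concatMap-map;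
         filter-accept; filter-reject)
open import Data.List.Relation.Binary.Disjoint.Propositional using (Disjoint)
open import Data.List.Relation.Binary.Permutation.Propositional
  using (_↭_; prep; swap; ↭-sym) renaming (refl to ↭-refl; trans to ↭-trans)
open import Data.List.Relation.Binary.Permutation.Propositional.Properties using (shift; ↭-singleton-inv)
open import Data.List.Relation.Unary.All as All using (All; []; _∷_)
import Data.List.Relation.Unary.All.Properties as Allᴾ
open import Data.List.Relation.Unary.AllPairs as AllPairs using (AllPairs; []; _∷_)
import Data.List.Relation.Unary.AllPairs.Properties as AllPairsᴾ
open import Data.List.Relation.Unary.Any as Any using (Any; here; there)
open import Data.List.Relation.Unary.Unique.Propositional using (Unique)
import Data.List.Relation.Unary.Unique.Propositional.Properties as Uniqueᴾ
open import Data.Nat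
  using (ℕ; zero; suc; _+_; _*_; _∸_; _/_; _%_; _≤_; _<_; _≤ᵇ_; _<ᵇ_; _≟_; _<?_; _≤?_; z≤n; s≤s; z<s; ⌊_/2⌋; ⌈_/2⌉)
open import Data.Nat.DivMod using (m%n<n; m*n/n≡m)
open import Data.Nat.ListAction using (sum)
open import Data.Nat.Properties
import Data.Nat.Solver as ℕ-Solver
open import Data.Product using (_×_; _,_; Σ; ∃; proj₁; proj₂)
open import Data.Sum using (_⊎_; inj₁; inj₂)
open import Function using (_∘_; id)
open import Relation.Binary.Definitions using (tri<; tri≈; tri>)
open import Relation.Binary.PropositionalEquality
open import Relation.Nullary using (¬_; yes; no)
open import Relation.Nullary.Decidable using (True; toWitness)
open import Relation.Nullary.Reflects using (ofʸ; ofⁿ; det)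

open import Data.List.Membership.DecPropositional (≡-dec _≟_) using (_∈?_)
open +-*-Solver using (solve; _:+_; _:*_; _:-_; :-_; _:=_; con)
open ℕ-Solver.+-*-Solver using () renaming (solve to ℕ-solve; _:+_ to _⊕_; _:*_ to _⊛_; _:=_ to _⊜_; con to ℕ-con)

+-interchange : ∀ a b c d → (a + b) + (c + d) ≡ (a + c) + (b + d)
+-interchange = interchange +-commutativeSemigroup

<ᵇ-true : ∀ {m n} → m < n → (m <ᵇ n) ≡ true
<ᵇ-true m<n = det (<ᵇ-reflects-< _ _) (ofʸ m<n)

<ᵇ-false : ∀ {m n} → n ≤ m → (m <ᵇ n) ≡ false
<ᵇ-false n≤m = det (<ᵇ-reflects-< _ _) (ofⁿ (≤⇒≯ n≤m))

≤ᵇ-true : ∀ {m n} → m ≤ n → (m ≤ᵇ n) ≡ true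
≤ᵇ-true m≤n = det (≤ᵇ-reflects-≤ _ _) (ofʸ m≤n)

≤ᵇ-false : ∀ {m n} → n < m → (m ≤ᵇ n) ≡ false
≤ᵇ-false n<m = det (≤ᵇ-reflects-≤ _ _) (ofⁿ (<⇒≱ n<m))

≤ᵇ-suc : ∀ m n → (suc m ≤ᵇ suc n) ≡ (m ≤ᵇ n)
≤ᵇ-suc zero    n = refl
≤ᵇ-suc (suc m) n = refl

<ᵇ-suc : ∀ m n → (m <ᵇ suc n) ≡ (m ≤ᵇ n)
<ᵇ-suc zero    n = refl
<ᵇ-suc (suc m) n = refl

<ᵇ-not-≤ᵇ : ∀ m n → (m <ᵇ n) ≡ not (n ≤ᵇ m)
<ᵇ-not-≤ᵇ m       zero    = refl
<ᵇ-not-≤ᵇ zero    (suc n) = refl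
<ᵇ-not-≤ᵇ (suc m) (suc n) = trans (<ᵇ-not-≤ᵇ m n) (cong not (sym (≤ᵇ-suc n m)))

module _ {f : ℕ → ℕ} (f-mono : ∀ {a b} → a < b → f a < f b) where

  strictMono-<ᵇ : ∀ a b → (f a <ᵇ f b) ≡ (a <ᵇ b)
  strictMono-<ᵇ a b with <-cmp a b
  ... | tri< a<b _ _ = trans (<ᵇ-true (f-mono a<b)) (sym (<ᵇ-true a<b))
  ... | tri≈ _ refl _ = trans (<ᵇ-false {f a} ≤-refl) (sym (<ᵇ-false {a} ≤-refl))
  ... | tri> _ _ b<a = trans (<ᵇ-false (<⇒≤ (f-mono b<a))) (sym (<ᵇ-false (<⇒≤ b<a)))

  strictMono-injective : ∀ {a b} → f a ≡ f b → a ≡ b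
  strictMono-injective {a} {b} fa≡fb with <-cmp a b
  ... | tri< a<b _ _ = ⊥-elim (<⇒≢ (f-mono a<b) fa≡fb)
  ... | tri≈ _ a≡b _ = a≡b
  ... | tri> _ _ b<a = ⊥-elim (<⇒≢ (f-mono b<a) (sym fa≡fb))

relabel-below : ∀ {x i} → suc i < x → relabel x i ≡ suc i
relabel-below {x} {i} p rewrite +-comm i 1 | <ᵇ-true p = refl

relabel-above : ∀ {x i} → x ≤ suc i → relabel x i ≡ suc (suc i)
relabel-above {x} {i} p rewrite +-comm i 1 | <ᵇ-false p | +-comm i 2 = refl

data RelabelView (x i : ℕ) : Set where
  below : suc i < x → relabel x i ≡ suc i → RelabelView x i
  above : x ≤ suc i → relabel x i ≡ suc (suc i) → RelabelView x i

relabelView : ∀ x i → RelabelView x i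
relabelView x i with suc i <? x
... | yes p = below p (relabel-below p)
... | no ¬p = above (≮⇒≥ ¬p) (relabel-above (≮⇒≥ ¬p))

relabel-positive : ∀ x i → 1 ≤ relabel x i
relabel-positive x i with relabelView x i
... | below _ e rewrite e = s≤s z≤n
... | above _ e rewrite e = s≤s z≤n

relabel-mono-< : ∀ x {a b} → a < b → relabel x a < relabel x b
relabel-mono-< x {a} {b} a<b with relabelView x a | relabelView x b
... | below _ e | below _ f rewrite e | f = s≤s a<b
... | above _ e | above _ f rewrite e | f = s≤s (s≤s a<b)
... | below _ e | above _ f rewrite e | f = s≤s (m≤n⇒m≤1+n a<b)
... | above p _ | below q _ = ⊥-elim (<-asym a<b (≤-pred (≤-trans q p)))

relabel-<ᵇ : ∀ x a b → (relabel x a <ᵇ relabel x b) ≡ (a <ᵇ b)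
relabel-<ᵇ x = strictMono-<ᵇ (relabel-mono-< x)

relabel-injective : ∀ x {a b} → relabel x a ≡ relabel x b → a ≡ b
relabel-injective x = strictMono-injective (relabel-mono-< x)

relabelEdge : ℕ → ℕ × ℕ → ℕ × ℕ
relabelEdge x (a , b) = relabel x a , relabel x b

relabel-above-<ᵇ : ∀ {x q} y → x ≤ suc q → (suc (suc q) <ᵇ relabel x y) ≡ (q <ᵇ y)
relabel-above-<ᵇ {x} {q} y x≤ =
  trans (cong (_<ᵇ relabel x y) (sym (relabel-above x≤))) (relabel-<ᵇ x q y)

relabel-below-<ᵇ : ∀ {x q} y → suc q < x → (suc q <ᵇ relabel x y) ≡ (q <ᵇ y)
relabel-below-<ᵇ {x} {q} y q<x =
  trans (cong (_<ᵇ relabel x y) (sym (relabel-below q<x))) (relabel-<ᵇ x q y)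

edgesFrom-relabel : ∀ x q ys → x ≤ suc q →
  edgesFrom (suc (suc q)) (map (relabel x) ys) ≡ map (relabelEdge x) (edgesFrom q ys)
edgesFrom-relabel x q [] x≤ = refl
edgesFrom-relabel x q (y ∷ ys) x≤ rewrite relabel-above-<ᵇ y x≤ with q <ᵇ y
... | true  = cong₂ _∷_ (cong (_, relabel x y) (sym (relabel-above x≤))) rest
  where rest = edgesFrom-relabel x (suc q) ys (m≤n⇒m≤1+n x≤)
... | false = edgesFrom-relabel x (suc q) ys (m≤n⇒m≤1+n x≤)

edgesFrom-insert : ∀ x q k ys → k + suc q ≡ x →
  edgesFrom (suc q) (insertAt k 1 (map (relabel x) ys)) ≡ map (relabelEdge x) (edgesFrom q ys)
edgesFrom-insert x q zero ys refl = edgesFrom-relabel x q ys ≤-refl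
edgesFrom-insert x q (suc k) [] _ = refl
edgesFrom-insert .(suc k + suc q) q (suc k) (y ∷ ys) refl
  rewrite relabel-below-<ᵇ y (m<n+m (suc q) {suc k} z<s) with q <ᵇ y
... | true  = cong₂ _∷_ (cong (_, relabel (suc k + suc q) y) (sym (relabel-below (m<n+m (suc q) z<s)))) rest
  where rest = edgesFrom-insert (suc k + suc q) (suc q) k ys (+-suc k (suc q))
... | false = edgesFrom-insert (suc k + suc q) (suc q) k ys (+-suc k (suc q))

edges-child : ∀ v k →
  edges (child v (2 + k)) ≡ (1 , 2 + k) ∷ map (relabelEdge (2 + k)) (edges v)
edges-child v k = cong ((1 , 2 + k) ∷_) (edgesFrom-insert (2 + k) 1 k v (+-comm k 2))

IsEdge : ℕ × ℕ → Set
IsEdge (a , b) = 1 ≤ a × a < b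

edgesFrom-IsEdge : ∀ q ys → 1 ≤ q → All IsEdge (edgesFrom q ys)
edgesFrom-IsEdge q [] _ = []
edgesFrom-IsEdge q (y ∷ ys) 1≤q with q <ᵇ y in q<y
... | true  = (1≤q , <ᵇ⇒< q y (subst T (sym q<y) _)) ∷ rest
  where rest = edgesFrom-IsEdge (suc q) ys (m≤n⇒m≤1+n 1≤q)
... | false = edgesFrom-IsEdge (suc q) ys (m≤n⇒m≤1+n 1≤q)

edges-IsEdge : ∀ v → All IsEdge (edges v)
edges-IsEdge v = edgesFrom-IsEdge 1 v ≤-refl

relabel-≤ᵇ-below : ∀ {k j} b → j ≤ k → (relabel (2 + k) b ≤ᵇ suc j) ≡ (b ≤ᵇ j)
relabel-≤ᵇ-below {k} {j} b j≤k with relabelView (2 + k) b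
... | below _ e rewrite e = ≤ᵇ-suc b j
... | above p e rewrite e =
  trans (≤ᵇ-false (s≤s (m≤n⇒m≤1+n j<b))) (sym (≤ᵇ-false j<b))
  where j<b = ≤-trans (s≤s j≤k) (≤-pred p)

relabel-≤ᵇ-above : ∀ {k j} b → k ≤ j → (relabel (2 + k) b ≤ᵇ 2 + j) ≡ (b ≤ᵇ j)
relabel-≤ᵇ-above {k} {j} b k≤j with relabelView (2 + k) b
... | below p e rewrite e =
  trans (≤ᵇ-true (s≤s (m≤n⇒m≤1+n b≤j))) (sym (≤ᵇ-true b≤j))
  where b≤j = ≤-trans (≤-pred (≤-pred p)) k≤j
... | above _ e rewrite e = trans (≤ᵇ-suc (suc b) (suc j)) (≤ᵇ-suc b j)

relabel-<ᵇ-new : ∀ k a → (relabel (2 + k) a <ᵇ 2 + k) ≡ (a ≤ᵇ k)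
relabel-<ᵇ-new k a = trans (<ᵇ-suc (relabel (2 + k) a) (suc k)) (relabel-≤ᵇ-below a ≤-refl)

new-<ᵇ-relabel : ∀ k b → (2 + k <ᵇ relabel (2 + k) b) ≡ not (b ≤ᵇ k)
new-<ᵇ-relabel k b = trans (<ᵇ-not-≤ᵇ (2 + k) (relabel (2 + k) b)) (cong not (relabel-≤ᵇ-above b ≤-refl))

indicator : Bool → ℕ
indicator b = if b then 1 else 0

count : {A : Set} → (A → Bool) → List A → ℕ
count p xs = sum (map (λ a → indicator (p a)) xs)

module _ {A : Set} where

  count-cong : ∀ {p q : A → Bool} xs → (∀ a → p a ≡ q a) → count p xs ≡ count q xs
  count-cong xs p≗q = cong sum (map-cong (cong indicator ∘ p≗q) xs)

  count-congᴬ : ∀ {P : A → Set} {p q : A → Bool} {xs} →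
    (∀ {a} → P a → p a ≡ q a) → All P xs → count p xs ≡ count q xs
  count-congᴬ p≗q Pxs = cong sum (map-cong-local (All.map (cong indicator ∘ p≗q) Pxs))

  count-none : ∀ {p : A → Bool} xs → (∀ a → p a ≡ false) → count p xs ≡ 0
  count-none [] never = refl
  count-none (x ∷ xs) never rewrite never x = count-none xs never

  count-map : ∀ {B : Set} (p : B → Bool) (f : A → B) xs → count p (map f xs) ≡ count (p ∘ f) xs
  count-map p f xs = cong sum (sym (map-∘ xs))

  sum-map-+ : ∀ (f g : A → ℕ) xs → sum (map (λ a → f a + g a) xs) ≡ sum (map f xs) + sum (map g xs)
  sum-map-+ f g [] = refl
  sum-map-+ f g (x ∷ xs) rewrite sum-map-+ f g xs = +-interchange (f x) (g x) _ _

countPairs-cons : ∀ r e es → countPairs r (e ∷ es) ≡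
  indicator (r e e) + count (r e) es + (count (λ a → r a e) es + countPairs r es)
countPairs-cons r e es =
  cong ((indicator (r e e) + count (r e) es) +_) (sum-map-+ (λ a → indicator (r a e)) (λ a → count (r a) es) es)

countPairs-map : ∀ r f es → (∀ a b → r (f a) (f b) ≡ r a b) → countPairs r (map f es) ≡ countPairs r es
countPairs-map r f es r∘f≡r = begin
  sum (map (λ a → count (r a) (map f es)) (map f es)) ≡⟨ cong sum (sym (map-∘ es)) ⟩
  sum (map (λ a → count (r (f a)) (map f es)) es)     ≡⟨ cong sum (map-cong rows es) ⟩
  sum (map (λ a → count (r a) es) es)                 ∎
  where
  open ≡-Reasoning
  rows : ∀ a → count (r (f a)) (map f es) ≡ count (r a) es
  rows a = trans (count-map (r (f a)) f es) (count-cong es (r∘f≡r a))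

-- The edges met by the gap between vertices k and k + 1, and the edges
-- lying entirely to its left.
cut closedBy : List (ℕ × ℕ) → ℕ → ℕ
cut      es k = count (λ e → (proj₁ e ≤ᵇ k) ∧ not (proj₂ e ≤ᵇ k)) es
closedBy es k = count (λ e → proj₂ e ≤ᵇ k) es

crossesᵇ-relabel : ∀ x A B → crossesᵇ (relabelEdge x A) (relabelEdge x B) ≡ crossesᵇ A B
crossesᵇ-relabel x (a , a') (b , b')
  rewrite relabel-<ᵇ x a b | relabel-<ᵇ x b a' | relabel-<ᵇ x a' b' = refl

nestsᵇ-relabel : ∀ x A B → nestsᵇ (relabelEdge x A) (relabelEdge x B) ≡ nestsᵇ A B
nestsᵇ-relabel x (a , a') (b , b')
  rewrite relabel-<ᵇ x a b | relabel-<ᵇ x b b' | relabel-<ᵇ x b' a' = refl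

one-<ᵇ-relabel : ∀ x a → 1 ≤ a → (1 <ᵇ relabel x a) ≡ true
one-<ᵇ-relabel x a 1≤a = <ᵇ-true (≤-<-trans (relabel-positive x 0) (relabel-mono-< x 1≤a))

relabel-<ᵇ-one : ∀ x a → (relabel x a <ᵇ 1) ≡ false
relabel-<ᵇ-one x a = <ᵇ-false (relabel-positive x a)

-- Adding the edge {1, 2 + k} creates one crossing (resp. nesting) with
-- each edge met by (resp. left of) the gap after vertex k, and no other.
module _ (r : ℕ × ℕ → ℕ × ℕ → Bool) (v : Matching) (k : ℕ)
         (r-relabel : ∀ A B → r (relabelEdge (2 + k) A) (relabelEdge (2 + k) B) ≡ r A B)
         (r-self : r (1 , 2 + k) (1 , 2 + k) ≡ false)
         (r-first : ∀ A → r (relabelEdge (2 + k) A) (1 , 2 + k) ≡ false) where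

  countPairs-child : countPairs r (edges (child v (2 + k))) ≡
    countPairs r (edges v) + count (r (1 , 2 + k) ∘ relabelEdge (2 + k)) (edges v)
  countPairs-child = begin
    countPairs r (edges (child v x))
      ≡⟨ cong (countPairs r) (edges-child v k) ⟩
    countPairs r ((1 , x) ∷ es')
      ≡⟨ countPairs-cons r (1 , x) es' ⟩
    indicator (r (1 , x) (1 , x)) + count (r (1 , x)) es' + (count (λ a → r a (1 , x)) es' + countPairs r es')
      ≡⟨ cong₂ (λ a b → indicator a + count (r (1 , x)) es' + b) r-self (cong₂ _+_ none (countPairs-map r _ (edges v) r-relabel)) ⟩
    count (r (1 , x)) es' + countPairs r (edges v)
      ≡⟨ cong (_+ countPairs r (edges v)) (count-map (r (1 , x)) _ (edges v)) ⟩
    count (r (1 , x) ∘ relabelEdge x) (edges v) + countPairs r (edges v)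
      ≡⟨ +-comm _ (countPairs r (edges v)) ⟩
    countPairs r (edges v) + count (r (1 , x) ∘ relabelEdge x) (edges v) ∎
    where
    open ≡-Reasoning
    x = 2 + k
    es' = map (relabelEdge x) (edges v)
    none : count (λ a → r a (1 , x)) es' ≡ 0
    none = trans (count-map _ (relabelEdge x) (edges v))
                 (count-none (edges v) r-first)

cr-child : ∀ v k → cr (child v (2 + k)) ≡ cr v + cut (edges v) k
cr-child v k =
  trans (countPairs-child crossesᵇ v k (crossesᵇ-relabel (2 + k)) refl first)
        (cong (cr v +_) (count-congᴬ crossing (edges-IsEdge v)))
  where
  first : ∀ A → crossesᵇ (relabelEdge (2 + k) A) (1 , 2 + k) ≡ false
  first (a , _) rewrite relabel-<ᵇ-one (2 + k) a = refl
  crossing : ∀ {B} → IsEdge B →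
    crossesᵇ (1 , 2 + k) (relabelEdge (2 + k) B) ≡ ((proj₁ B ≤ᵇ k) ∧ not (proj₂ B ≤ᵇ k))
  crossing {a , b} (1≤a , _)
    rewrite one-<ᵇ-relabel (2 + k) a 1≤a | relabel-<ᵇ-new k a | new-<ᵇ-relabel k b = refl

ne-child : ∀ v k → ne (child v (2 + k)) ≡ ne v + closedBy (edges v) k
ne-child v k =
  trans (countPairs-child nestsᵇ v k (nestsᵇ-relabel (2 + k)) refl first)
        (cong (ne v +_) (count-congᴬ nesting (edges-IsEdge v)))
  where
  first : ∀ A → nestsᵇ (relabelEdge (2 + k) A) (1 , 2 + k) ≡ false
  first (a , _) rewrite relabel-<ᵇ-one (2 + k) a = refl
  nesting : ∀ {B} → IsEdge B → nestsᵇ (1 , 2 + k) (relabelEdge (2 + k) B) ≡ (proj₂ B ≤ᵇ k)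
  nesting {a , b} (1≤a , a<b)
    rewrite one-<ᵇ-relabel (2 + k) a 1≤a | relabel-<ᵇ (2 + k) a b | <ᵇ-true a<b | relabel-<ᵇ-new k b = refl

cut-zero : ∀ w → cut (edges w) 0 ≡ 0
cut-zero w = trans (count-congᴬ {q = λ _ → false} noLeftEnd (edges-IsEdge w)) (count-none (edges w) λ _ → refl)
  where
  noLeftEnd : ∀ {B} → IsEdge B → ((proj₁ B ≤ᵇ 0) ∧ not (proj₂ B ≤ᵇ 0)) ≡ false
  noLeftEnd {suc a , _} _ = refl

closedBy-zero : ∀ w → closedBy (edges w) 0 ≡ 0
closedBy-zero w = trans (count-congᴬ {q = λ _ → false} noRightEnd (edges-IsEdge w)) (count-none (edges w) λ _ → refl)
  where
  noRightEnd : ∀ {B} → IsEdge B → (proj₂ B ≤ᵇ 0) ≡ false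
  noRightEnd {_ , suc b} _ = refl

module _ (v : Matching) (k : ℕ) where

  private
    c  = child v (2 + k)
    es = edges v

  count-child : ∀ p → count p (edges c) ≡ indicator (p (1 , 2 + k)) + count (p ∘ relabelEdge (2 + k)) es
  count-child p = trans (cong (count p) (edges-child v k)) (cong (indicator (p (1 , 2 + k)) +_) (count-map p _ es))

  closedBy-child-below : ∀ j → j ≤ k → closedBy (edges c) (suc j) ≡ closedBy es j
  closedBy-child-below j j≤k rewrite count-child (λ e → proj₂ e ≤ᵇ suc j) | ≤ᵇ-false (s≤s (s≤s j≤k)) =
    count-cong es λ B → relabel-≤ᵇ-below (proj₂ B) j≤k

  closedBy-child-above : ∀ j → k ≤ j → closedBy (edges c) (2 + j) ≡ suc (closedBy es j)
  closedBy-child-above j k≤j rewrite count-child (λ e → proj₂ e ≤ᵇ 2 + j) | ≤ᵇ-true (s≤s (s≤s k≤j)) =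
    cong suc (count-cong es λ B → relabel-≤ᵇ-above (proj₂ B) k≤j)

  cut-child-below : ∀ j → j ≤ k → cut (edges c) (suc j) ≡ suc (cut es j)
  cut-child-below j j≤k
    rewrite count-child (λ e → (proj₁ e ≤ᵇ suc j) ∧ not (proj₂ e ≤ᵇ suc j)) | ≤ᵇ-false (s≤s (s≤s j≤k)) =
    cong suc (count-cong es λ B → cong₂ (λ a b → a ∧ not b) (relabel-≤ᵇ-below (proj₁ B) j≤k) (relabel-≤ᵇ-below (proj₂ B) j≤k))

  cut-child-above : ∀ j → k ≤ j → cut (edges c) (2 + j) ≡ cut es j
  cut-child-above j k≤j
    rewrite count-child (λ e → (proj₁ e ≤ᵇ 2 + j) ∧ not (proj₂ e ≤ᵇ 2 + j)) | ≤ᵇ-true (s≤s (s≤s k≤j)) =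
    count-cong es λ B → cong₂ (λ a b → a ∧ not b) (relabel-≤ᵇ-above (proj₁ B) k≤j) (relabel-≤ᵇ-above (proj₂ B) k≤j)

-1^_ : ℕ → ℤ
-1^ zero  = 1ℤ
-1^ suc n = - (-1^ n)

-1^-+ : ∀ m n → -1^ (m + n) ≡ (-1^ m) ℤ.* (-1^ n)
-1^-+ zero    n = sym (ℤ.*-identityˡ (-1^ n))
-1^-+ (suc m) n = trans (cong -_ (-1^-+ m n)) (ℤ.neg-distribˡ-* (-1^ m) (-1^ n))

-1^-2+ : ∀ n → -1^ (2 + n) ≡ -1^ n
-1^-2+ n = ℤ.neg-involutive (-1^ n)

-1^-square : ∀ n → (-1^ n) ℤ.* (-1^ n) ≡ 1ℤ
-1^-square zero    = refl
-1^-square (suc n) = trans (solve 1 (λ a → (:- a) :* (:- a) := a :* a) refl (-1^ n)) (-1^-square n)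

-1^-%2 : ∀ n → -1^ (n % 2) ≡ -1^ n
-1^-%2 zero          = refl
-1^-%2 (suc zero)    = refl
-1^-%2 (suc (suc n)) = trans (-1^-%2 n) (sym (-1^-2+ n))

-1^-*-cancel : ∀ n {x y} → -1^ n ℤ.* x ≡ -1^ n ℤ.* y → x ≡ y
-1^-*-cancel n {x} {y} e = begin
  x                 ≡⟨ sym (ℤ.*-identityˡ x) ⟩
  1ℤ ℤ.* x          ≡⟨ cong (ℤ._* x) (sym (-1^-square n)) ⟩
  σ ℤ.* σ ℤ.* x     ≡⟨ ℤ.*-assoc σ σ x ⟩
  σ ℤ.* (σ ℤ.* x)   ≡⟨ cong (σ ℤ.*_) e ⟩
  σ ℤ.* (σ ℤ.* y)   ≡⟨ sym (ℤ.*-assoc σ σ y) ⟩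
  σ ℤ.* σ ℤ.* y     ≡⟨ cong (ℤ._* y) (-1^-square n) ⟩
  1ℤ ℤ.* y          ≡⟨ ℤ.*-identityˡ y ⟩
  y                 ∎
  where
  open ≡-Reasoning
  σ = -1^ n

%2-≡⇒-1^-≡ : ∀ m n → m % 2 ≡ n % 2 → -1^ m ≡ -1^ n
%2-≡⇒-1^-≡ m n e = trans (sym (-1^-%2 m)) (trans (cong -1^_ e) (-1^-%2 n))

∑ : ℕ → (ℕ → ℤ) → ℤ
∑ zero    f = 0ℤ
∑ (suc n) f = f 0 ℤ.+ ∑ n (f ∘ suc)

∑-cong : ∀ n {f g : ℕ → ℤ} → (∀ j → j < n → f j ≡ g j) → ∑ n f ≡ ∑ n g
∑-cong zero    f≗g = refl
∑-cong (suc n) f≗g = cong₂ ℤ._+_ (f≗g 0 z<s) (∑-cong n (λ j j<n → f≗g (suc j) (s≤s j<n)))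

∑-+ : ∀ n f g → ∑ n (λ k → f k ℤ.+ g k) ≡ ∑ n f ℤ.+ ∑ n g
∑-+ zero    f g = refl
∑-+ (suc n) f g rewrite ∑-+ n (f ∘ suc) (g ∘ suc) =
  solve 4 (λ a b c d → (a :+ b) :+ (c :+ d) := (a :+ c) :+ (b :+ d)) refl (f 0) (g 0) (∑ n (f ∘ suc)) (∑ n (g ∘ suc))

∑-* : ∀ n c f → ∑ n (λ k → c ℤ.* f k) ≡ c ℤ.* ∑ n f
∑-* zero    c f = sym (ℤ.*-zeroʳ c)
∑-* (suc n) c f rewrite ∑-* n c (f ∘ suc) = sym (ℤ.*-distribˡ-+ c (f 0) _)

∑-neg : ∀ n f → ∑ n (λ k → - f k) ≡ - ∑ n f
∑-neg zero    f = refl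
∑-neg (suc n) f rewrite ∑-neg n (f ∘ suc) = sym (ℤ.neg-distrib-+ (f 0) _)

∑-split : ∀ a b f → ∑ (a + b) f ≡ ∑ a f ℤ.+ ∑ b (λ i → f (a + i))
∑-split zero    b f = sym (ℤ.+-identityˡ _)
∑-split (suc a) b f rewrite ∑-split a b (f ∘ suc) = sym (ℤ.+-assoc (f 0) _ _)

∑-alternating : ∀ m → ∑ (suc (m + m)) -1^_ ≡ 1ℤ
∑-alternating zero    = refl
∑-alternating (suc m) = begin
  ∑ (suc (suc m + suc m)) -1^_               ≡⟨ cong (λ n → ∑ (suc (suc n)) -1^_) (+-suc m m) ⟩
  1ℤ ℤ.+ (-1ℤ ℤ.+ ∑ (suc (m + m)) (-1^_ ∘ (2 +_)))
    ≡⟨ cong (λ z → 1ℤ ℤ.+ (-1ℤ ℤ.+ z)) (∑-cong (suc (m + m)) λ k _ → -1^-2+ k) ⟩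
  1ℤ ℤ.+ (-1ℤ ℤ.+ ∑ (suc (m + m)) -1^_)    ≡⟨ solve 1 (λ x → con 1ℤ :+ (con -1ℤ :+ x) := x) refl _ ⟩
  ∑ (suc (m + m)) -1^_                       ≡⟨ ∑-alternating m ⟩
  1ℤ                                         ∎
  where open ≡-Reasoning

-- Both ∑ₖ ∑_{j ≤ k} f k f j and ∑ₖ ∑_{j ≥ k} f k f j are the sum of f j f k over all j ≤ k.
∑-prefix≡suffix : ∀ n f → ∑ n (λ k → f k ℤ.* (∑ (suc k) f ℤ.- ∑ (n ∸ k) (λ i → f (k + i)))) ≡ 0ℤ
∑-prefix≡suffix zero    f = refl
∑-prefix≡suffix (suc n) f = begin
  f 0 ℤ.* ((f 0 ℤ.+ 0ℤ) ℤ.- (f 0 ℤ.+ ∑ n f')) ℤ.+ ∑ n (λ k → f' k ℤ.* ((f 0 ℤ.+ ∑ (suc k) f') ℤ.- ∑ (n ∸ k) (λ i → f' (k + i))))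
    ≡⟨ cong (ℤ._+_ (head)) (∑-cong n λ k _ → split k) ⟩
  head ℤ.+ ∑ n (λ k → f 0 ℤ.* f' k ℤ.+ rest k)
    ≡⟨ cong (ℤ._+_ (head)) (trans (∑-+ n _ rest) (cong₂ ℤ._+_ (∑-* n (f 0) f') (∑-prefix≡suffix n f'))) ⟩
  head ℤ.+ (f 0 ℤ.* ∑ n f' ℤ.+ 0ℤ)
    ≡⟨ solve 2 (λ a r → a :* ((a :+ con 0ℤ) :- (a :+ r)) :+ (a :* r :+ con 0ℤ) := con 0ℤ) refl (f 0) (∑ n f') ⟩
  0ℤ ∎
  where
  open ≡-Reasoning
  f' = f ∘ suc
  head = f 0 ℤ.* ((f 0 ℤ.+ 0ℤ) ℤ.- (f 0 ℤ.+ ∑ n f'))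
  rest : ℕ → ℤ
  rest k = f' k ℤ.* (∑ (suc k) f' ℤ.- ∑ (n ∸ k) (λ i → f' (k + i)))
  split : ∀ k → f' k ℤ.* ((f 0 ℤ.+ ∑ (suc k) f') ℤ.- ∑ (n ∸ k) (λ i → f' (k + i))) ≡ f 0 ℤ.* f' k ℤ.+ rest k
  split k = solve 4 (λ a b c d → b :* ((a :+ c) :- d) := a :* b :+ b :* (c :- d)) refl
                   (f 0) (f' k) (∑ (suc k) f') (∑ (n ∸ k) (λ i → f' (k + i)))

sumℤ : {A : Set} → (A → ℤ) → List A → ℤ
sumℤ f []       = 0ℤ
sumℤ f (x ∷ xs) = f x ℤ.+ sumℤ f xs

module _ {A : Set} where

  sumℤ-++ : ∀ (f : A → ℤ) xs ys → sumℤ f (xs ++ ys) ≡ sumℤ f xs ℤ.+ sumℤ f ys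
  sumℤ-++ f []       ys = sym (ℤ.+-identityˡ _)
  sumℤ-++ f (x ∷ xs) ys = trans (cong (ℤ._+_ (f x)) (sumℤ-++ f xs ys)) (sym (ℤ.+-assoc (f x) _ _))

  sumℤ-cong : ∀ {f g : A → ℤ} xs → (∀ a → f a ≡ g a) → sumℤ f xs ≡ sumℤ g xs
  sumℤ-cong []       f≗g = refl
  sumℤ-cong (x ∷ xs) f≗g = cong₂ ℤ._+_ (f≗g x) (sumℤ-cong xs f≗g)

  sumℤ-congᴬ : ∀ {f g : A → ℤ} {xs} → All (λ a → f a ≡ g a) xs → sumℤ f xs ≡ sumℤ g xs
  sumℤ-congᴬ []         = refl
  sumℤ-congᴬ (e ∷ es) = cong₂ ℤ._+_ e (sumℤ-congᴬ es)

  sumℤ-↭ : ∀ (f : A → ℤ) {xs ys} → xs ↭ ys → sumℤ f xs ≡ sumℤ f ys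
  sumℤ-↭ f ↭-refl        = refl
  sumℤ-↭ f (prep x p)    = cong (ℤ._+_ (f x)) (sumℤ-↭ f p)
  sumℤ-↭ f (swap x y p)  = trans (sym (ℤ.+-assoc (f x) (f y) _))
    (trans (cong₂ ℤ._+_ (ℤ.+-comm (f x) (f y)) (sumℤ-↭ f p)) (ℤ.+-assoc (f y) (f x) _))
  sumℤ-↭ f (↭-trans p q) = trans (sumℤ-↭ f p) (sumℤ-↭ f q)

  module _ {B : Set} where

    sumℤ-map : ∀ (f : A → ℤ) (g : B → A) xs → sumℤ f (map g xs) ≡ sumℤ (f ∘ g) xs
    sumℤ-map f g []       = refl
    sumℤ-map f g (x ∷ xs) = cong (ℤ._+_ (f (g x))) (sumℤ-map f g xs)

    sumℤ-concatMap : ∀ (f : A → ℤ) (g : B → List A) xs → sumℤ f (concatMap g xs) ≡ sumℤ (sumℤ f ∘ g) xs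
    sumℤ-concatMap f g []       = refl
    sumℤ-concatMap f g (x ∷ xs) = trans (sumℤ-++ f (g x) _) (cong (ℤ._+_ (sumℤ f (g x))) (sumℤ-concatMap f g xs))

sumℤ-applyUpTo : ∀ (f : ℕ → ℤ) g n → sumℤ f (applyUpTo g n) ≡ ∑ n (f ∘ g)
sumℤ-applyUpTo f g zero    = refl
sumℤ-applyUpTo f g (suc n) = cong (ℤ._+_ (f (g 0))) (sumℤ-applyUpTo f (g ∘ suc) n)

length-insertAt : ∀ k (a : ℕ) xs → length (insertAt k a xs) ≡ suc (length xs)
length-insertAt zero    a xs       = refl
length-insertAt (suc k) a []       = refl
length-insertAt (suc k) a (y ∷ ys) = cong suc (length-insertAt k a ys)

length-child : ∀ v x → length (child v x) ≡ 2 + length v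
length-child v x = cong suc (trans (length-insertAt (x ∸ 2) 1 (map (relabel x) v)) (cong suc (length-map (relabel x) v)))

concatMap-concatMap : ∀ {A B C : Set} (f : A → List B) (g : B → List C) xs →
  concatMap g (concatMap f xs) ≡ concatMap (concatMap g ∘ f) xs
concatMap-concatMap f g []       = refl
concatMap-concatMap f g (x ∷ xs) =
  trans (concatMap-++ g (f x) (concatMap f xs)) (cong (concatMap g (f x) ++_) (concatMap-concatMap f g xs))

tree-suc : ∀ v l → tree v (suc l) ≡ concatMap (λ c → tree c l) (children v)
tree-suc v zero    = trans (++-identityʳ (children v)) (sym (concatMap-pure (children v)))
tree-suc v (suc l) = trans (cong (concatMap children) (tree-suc v l)) (concatMap-concatMap (λ c → tree c l) children (children v))

sumℤ-tree-suc : ∀ (f : Matching → ℤ) v l →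
  sumℤ f (tree v (suc l)) ≡ ∑ (suc (length v)) (λ k → sumℤ f (tree (child v (2 + k)) l))
sumℤ-tree-suc f v l = begin
  sumℤ f (tree v (suc l))                                    ≡⟨ cong (sumℤ f) (tree-suc v l) ⟩
  sumℤ f (concatMap (λ c → tree c l) (children v))           ≡⟨ sumℤ-concatMap f (λ c → tree c l) (children v) ⟩
  sumℤ (λ c → sumℤ f (tree c l)) (children v)                ≡⟨ sumℤ-map (λ c → sumℤ f (tree c l)) (λ k → child v (2 + k)) (upTo (suc (length v))) ⟩
  sumℤ subtree (upTo (suc (length v)))                       ≡⟨ sumℤ-applyUpTo subtree (λ k → k) (suc (length v)) ⟩
  ∑ (suc (length v)) subtree                                 ∎
  where
  open ≡-Reasoning
  subtree = λ k → sumℤ f (tree (child v (2 + k)) l)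

treeSize : ℕ → ℕ → ℕ
treeSize n zero    = 1
treeSize n (suc l) = suc n * treeSize (2 + n) l

length-concatMap : ∀ {A B : Set} (g : A → List B) c xs →
  All (λ a → length (g a) ≡ c) xs → length (concatMap g xs) ≡ length xs * c
length-concatMap g c []       []         = refl
length-concatMap g c (x ∷ xs) (gx ∷ gxs) = trans (length-++ (g x)) (cong₂ _+_ gx (length-concatMap g c xs gxs))

length-tree : ∀ l v → length (tree v l) ≡ treeSize (length v) l
length-tree zero    v = refl
length-tree (suc l) v = begin
  length (tree v (suc l))
    ≡⟨ cong length (trans (tree-suc v l) (concatMap-map (λ c → tree c l) (λ k → child v (2 + k)) (upTo (suc (length v))))) ⟩
  length (concatMap (λ k → tree (child v (2 + k)) l) (upTo (suc (length v))))
    ≡⟨ length-concatMap (λ k → tree (child v (2 + k)) l) (treeSize (2 + length v) l) (upTo (suc (length v))) (All.universal subtree _) ⟩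
  length (upTo (suc (length v))) * treeSize (2 + length v) l
    ≡⟨ cong (_* treeSize (2 + length v) l) (length-applyUpTo (λ k → k) (suc (length v))) ⟩
  treeSize (length v) (suc l) ∎
  where
  open ≡-Reasoning
  subtree : ∀ k → length (tree (child v (2 + k)) l) ≡ treeSize (2 + length v) l
  subtree k = trans (length-tree l (child v (2 + k))) (cong (λ n → treeSize n l) (length-child v (2 + k)))

-- The parity of the cut after vertex j is that of j: the j vertices to its
-- left are matched among themselves except for the endpoints of cut edges.
Balanced : Matching → Set
Balanced v = (∃ λ m → length v ≡ m + m) × (∀ j → j ≤ length v → -1^ cut (edges v) j ≡ -1^ j)

Balanced-child : ∀ v k → Balanced v → k ≤ length v → Balanced (child v (2 + k))
Balanced-child v k ((m , even) , cuts) k≤ =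
  (suc m , trans (length-child v (2 + k)) (cong suc (trans (cong suc even) (sym (+-suc m m))))) , cuts'
  where
  cuts' : ∀ j → j ≤ length (child v (2 + k)) → -1^ cut (edges (child v (2 + k))) j ≡ -1^ j
  cuts' zero _ = cong -1^_ (cut-zero (child v (2 + k)))
  cuts' (suc j) j< with j ≤? k
  ... | yes j≤k = trans (cong -1^_ (cut-child-below v k j j≤k)) (cong -_ (cuts j (≤-trans j≤k k≤)))
  cuts' (suc zero) _ | no j≰k = ⊥-elim (j≰k z≤n)
  cuts' (suc (suc j)) j< | no j≰k =
    trans (cong -1^_ (cut-child-above v k j (≤-pred (≰⇒> j≰k))))
          (trans (cuts j (≤-pred (≤-pred (subst (2 + j ≤_) (length-child v (2 + k)) j<)))) (sym (-1^-2+ j)))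

sumℤ-tree-cr : ∀ l v → Balanced v → sumℤ (-1^_ ∘ cr) (tree v l) ≡ -1^ cr v
sumℤ-tree-cr zero    v _ = ℤ.+-identityʳ _
sumℤ-tree-cr (suc l) v bal@((m , even) , cuts) = begin
  sumℤ (-1^_ ∘ cr) (tree v (suc l))                     ≡⟨ sumℤ-tree-suc (-1^_ ∘ cr) v l ⟩
  ∑ (suc (length v)) (λ k → sumℤ (-1^_ ∘ cr) (tree (child v (2 + k)) l))
    ≡⟨ ∑-cong (suc (length v)) (λ k k< → trans (sumℤ-tree-cr l (child v (2 + k)) (Balanced-child v k bal (≤-pred k<))) (perChild k (≤-pred k<))) ⟩
  ∑ (suc (length v)) (λ k → -1^ cr v ℤ.* -1^ k)          ≡⟨ ∑-* (suc (length v)) (-1^ cr v) -1^_ ⟩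
  -1^ cr v ℤ.* ∑ (suc (length v)) -1^_                   ≡⟨ cong (λ n → -1^ cr v ℤ.* ∑ (suc n) -1^_) even ⟩
  -1^ cr v ℤ.* ∑ (suc (m + m)) -1^_                       ≡⟨ cong (-1^ cr v ℤ.*_) (∑-alternating m) ⟩
  -1^ cr v ℤ.* 1ℤ                                         ≡⟨ ℤ.*-identityʳ _ ⟩
  -1^ cr v                                                ∎
  where
  open ≡-Reasoning
  perChild : ∀ k → k ≤ length v → -1^ cr (child v (2 + k)) ≡ -1^ cr v ℤ.* -1^ k
  perChild k k≤ = trans (cong -1^_ (cr-child v k)) (trans (-1^-+ (cr v) (cut (edges v) k)) (cong (-1^ cr v ℤ.*_) (cuts k k≤)))

closedSign : Matching → ℕ → ℤ
closedSign v k = -1^ closedBy (edges v) k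

-- ∑ over the children c of v of (-1)^(ne c - ne v).
nestingBalance : Matching → ℤ
nestingBalance v = ∑ (suc (length v)) (closedSign v)

nestingBalance-child : ∀ v k → k ≤ length v →
  nestingBalance (child v (2 + k)) ≡
  1ℤ ℤ.+ (∑ (suc k) (closedSign v) ℤ.- ∑ (suc (length v) ∸ k) (λ i → closedSign v (k + i)))
nestingBalance-child v k k≤ = begin
  ∑ (suc (length c)) (closedSign c)
    ≡⟨ cong (λ n → ∑ (suc n) (closedSign c)) (length-child v (2 + k)) ⟩
  closedSign c 0 ℤ.+ ∑ (2 + length v) (closedSign c ∘ suc)
    ≡⟨ cong (λ n → closedSign c 0 ℤ.+ ∑ n (closedSign c ∘ suc)) (sym (cong suc (m+[n∸m]≡n (m≤n⇒m≤1+n k≤)))) ⟩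
  closedSign c 0 ℤ.+ ∑ (suc k + (suc (length v) ∸ k)) (closedSign c ∘ suc)
    ≡⟨ cong₂ ℤ._+_ (cong -1^_ (closedBy-zero c)) (∑-split (suc k) (suc (length v) ∸ k) (closedSign c ∘ suc)) ⟩
  1ℤ ℤ.+ (∑ (suc k) (closedSign c ∘ suc) ℤ.+ ∑ (suc (length v) ∸ k) (λ i → closedSign c (2 + k + i)))
    ≡⟨ cong (ℤ._+_ 1ℤ) (cong₂ ℤ._+_ (∑-cong (suc k) left) (trans (∑-cong (suc (length v) ∸ k) right) (∑-neg (suc (length v) ∸ k) (λ i → closedSign v (k + i))))) ⟩
  1ℤ ℤ.+ (∑ (suc k) (closedSign v) ℤ.- ∑ (suc (length v) ∸ k) (λ i → closedSign v (k + i))) ∎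
  where
  open ≡-Reasoning
  c = child v (2 + k)
  left : ∀ j → j < suc k → closedSign c (suc j) ≡ closedSign v j
  left j j< = cong -1^_ (closedBy-child-below v k j (≤-pred j<))
  right : ∀ i → i < suc (length v) ∸ k → closedSign c (2 + k + i) ≡ - closedSign v (k + i)
  right i _ = cong -1^_ (closedBy-child-above v k (k + i) (m≤m+n k i))

nestingBalance-recurrence : ∀ v →
  ∑ (suc (length v)) (λ k → closedSign v k ℤ.* nestingBalance (child v (2 + k))) ≡ nestingBalance v
nestingBalance-recurrence v = begin
  ∑ n (λ k → s k ℤ.* nestingBalance (child v (2 + k)))
    ≡⟨ ∑-cong n (λ k k< → trans (cong (s k ℤ.*_) (nestingBalance-child v k (≤-pred k<))) (distrib k)) ⟩
  ∑ n (λ k → s k ℤ.+ s k ℤ.* (∑ (suc k) s ℤ.- ∑ (n ∸ k) (λ i → s (k + i))))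
    ≡⟨ ∑-+ n s (λ k → s k ℤ.* (∑ (suc k) s ℤ.- ∑ (n ∸ k) (λ i → s (k + i)))) ⟩
  nestingBalance v ℤ.+ ∑ n (λ k → s k ℤ.* (∑ (suc k) s ℤ.- ∑ (n ∸ k) (λ i → s (k + i))))
    ≡⟨ cong (ℤ._+_ (nestingBalance v)) (∑-prefix≡suffix n s) ⟩
  nestingBalance v ℤ.+ 0ℤ
    ≡⟨ ℤ.+-identityʳ _ ⟩
  nestingBalance v ∎
  where
  open ≡-Reasoning
  n = suc (length v)
  s = closedSign v
  distrib : ∀ k → s k ℤ.* (1ℤ ℤ.+ (∑ (suc k) s ℤ.- ∑ (n ∸ k) (λ i → s (k + i)))) ≡
                  s k ℤ.+ s k ℤ.* (∑ (suc k) s ℤ.- ∑ (n ∸ k) (λ i → s (k + i)))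
  distrib k = solve 2 (λ a b → a :* (con 1ℤ :+ b) := a :+ a :* b) refl (s k) _

-1^-ne-child : ∀ v k → -1^ ne (child v (2 + k)) ≡ -1^ ne v ℤ.* closedSign v k
-1^-ne-child v k = trans (cong -1^_ (ne-child v k)) (-1^-+ (ne v) (closedBy (edges v) k))

sumℤ-tree-ne : ∀ l v → sumℤ (-1^_ ∘ ne) (tree v (suc l)) ≡ -1^ ne v ℤ.* nestingBalance v
sumℤ-tree-ne zero v = begin
  sumℤ (-1^_ ∘ ne) (tree v 1)                          ≡⟨ sumℤ-tree-suc (-1^_ ∘ ne) v 0 ⟩
  ∑ n (λ k → -1^ ne (child v (2 + k)) ℤ.+ 0ℤ)          ≡⟨ ∑-cong n (λ k _ → trans (ℤ.+-identityʳ _) (-1^-ne-child v k)) ⟩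
  ∑ n (λ k → -1^ ne v ℤ.* closedSign v k)               ≡⟨ ∑-* n (-1^ ne v) (closedSign v) ⟩
  -1^ ne v ℤ.* nestingBalance v                         ∎
  where
  open ≡-Reasoning
  n = suc (length v)
sumℤ-tree-ne (suc l) v = begin
  sumℤ (-1^_ ∘ ne) (tree v (2 + l))                    ≡⟨ sumℤ-tree-suc (-1^_ ∘ ne) v (suc l) ⟩
  ∑ n (λ k → sumℤ (-1^_ ∘ ne) (tree (child v (2 + k)) (suc l)))
    ≡⟨ ∑-cong n (λ k _ → trans (sumℤ-tree-ne l (child v (2 + k))) (perChild k)) ⟩
  ∑ n (λ k → -1^ ne v ℤ.* (closedSign v k ℤ.* nestingBalance (child v (2 + k))))
    ≡⟨ ∑-* n (-1^ ne v) (λ k → closedSign v k ℤ.* nestingBalance (child v (2 + k))) ⟩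
  -1^ ne v ℤ.* ∑ n (λ k → closedSign v k ℤ.* nestingBalance (child v (2 + k)))
    ≡⟨ cong (-1^ ne v ℤ.*_) (nestingBalance-recurrence v) ⟩
  -1^ ne v ℤ.* nestingBalance v ∎
  where
  open ≡-Reasoning
  n = suc (length v)
  perChild : ∀ k → -1^ ne (child v (2 + k)) ℤ.* nestingBalance (child v (2 + k)) ≡
                   -1^ ne v ℤ.* (closedSign v k ℤ.* nestingBalance (child v (2 + k)))
  perChild k = trans (cong (ℤ._* nestingBalance (child v (2 + k))) (-1^-ne-child v k)) (ℤ.*-assoc (-1^ ne v) _ _)

+-cancel-double : ∀ {a b} → a + a ≡ b + b → a ≡ b
+-cancel-double {a} {b} e with <-cmp a b
... | tri< a<b _ _ = ⊥-elim (<⇒≢ (+-mono-< a<b a<b) e)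
... | tri≈ _ a≡b _ = a≡b
... | tri> _ _ b<a = ⊥-elim (<⇒≢ (+-mono-< b<a b<a) (sym e))

data Parity (n : ℕ) : Set where
  even : n % 2 ≡ 0 → -1^ n ≡ 1ℤ  → Parity n
  odd  : n % 2 ≡ 1 → -1^ n ≡ -1ℤ → Parity n

parity : ∀ n → Parity n
parity zero    = even refl refl
parity (suc zero) = odd refl refl
parity (suc (suc n)) with parity n
... | even p s = even p (trans (-1^-2+ n) s)
... | odd  p s = odd  p (trans (-1^-2+ n) s)

parities-normalForm : ∀ xs → Σ ℕ λ a → Σ ℕ λ b →
  (map (_% 2) xs ↭ replicate a 0 ++ replicate b 1) × length xs ≡ a + b × sumℤ -1^_ xs ≡ ℤ.+ a ℤ.- ℤ.+ b
parities-normalForm [] = 0 , 0 , ↭-refl , refl , refl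
parities-normalForm (x ∷ xs) with parities-normalForm xs | parity x
... | a , b , p , l , z | even x%2 s rewrite x%2 | s =
  suc a , b , prep 0 p , cong suc l ,
  trans (cong (ℤ._+_ 1ℤ) z) (solve 2 (λ a b → con 1ℤ :+ (a :- b) := (con 1ℤ :+ a) :- b) refl (ℤ.+ a) (ℤ.+ b))
... | a , b , p , l , z | odd x%2 s rewrite x%2 | s =
  a , suc b , ↭-trans (prep 1 p) (↭-sym (shift 1 (replicate a 0) (replicate b 1))) , trans (cong suc l) (sym (+-suc a b)) ,
  trans (cong (ℤ._+_ -1ℤ) z) (solve 2 (λ a b → con -1ℤ :+ (a :- b) := a :- (con 1ℤ :+ b)) refl (ℤ.+ a) (ℤ.+ b))

parities-↭ : ∀ xs ys → length xs ≡ length ys → sumℤ -1^_ xs ≡ sumℤ -1^_ ys → map (_% 2) xs ↭ map (_% 2) ys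
parities-↭ xs ys |xs|≡|ys| Σxs≡Σys with parities-normalForm xs | parities-normalForm ys
... | a , b , p , l , z | a' , b' , p' , l' , z' = ↭-trans p (subst₂ (λ u w → replicate u 0 ++ replicate w 1 ↭ map (_% 2) ys) (sym a≡a') (sym b≡b') (↭-sym p'))
  where
  a+b≡a'+b' : a + b ≡ a' + b'
  a+b≡a'+b' = trans (sym l) (trans |xs|≡|ys| l')
  2a≡2a' : ℤ.+ a ℤ.+ ℤ.+ a ≡ ℤ.+ a' ℤ.+ ℤ.+ a'
  2a≡2a' = begin
    ℤ.+ a ℤ.+ ℤ.+ a                           ≡⟨ solve 2 (λ u w → u :+ u := (u :- w) :+ (u :+ w)) refl (ℤ.+ a) (ℤ.+ b) ⟩
    (ℤ.+ a ℤ.- ℤ.+ b) ℤ.+ ℤ.+ (a + b)         ≡⟨ cong₂ ℤ._+_ (trans (sym z) (trans Σxs≡Σys z')) (cong ℤ.+_ a+b≡a'+b') ⟩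
    (ℤ.+ a' ℤ.- ℤ.+ b') ℤ.+ ℤ.+ (a' + b')     ≡⟨ solve 2 (λ u w → (u :- w) :+ (u :+ w) := u :+ u) refl (ℤ.+ a') (ℤ.+ b') ⟩
    ℤ.+ a' ℤ.+ ℤ.+ a'                         ∎
    where open ≡-Reasoning
  a≡a' : a ≡ a'
  a≡a' = +-cancel-double (ℤ.+-injective 2a≡2a')
  b≡b' : b ≡ b'
  b≡b' = +-cancelˡ-≡ a' b b' (subst (λ u → u + b ≡ a' + b') a≡a' a+b≡a'+b')

↭-parities⇒sumℤ : ∀ xs ys → map (_% 2) xs ↭ map (_% 2) ys → sumℤ -1^_ xs ≡ sumℤ -1^_ ys
↭-parities⇒sumℤ xs ys p = begin
  sumℤ -1^_ xs                  ≡⟨ sumℤ-cong xs (sym ∘ -1^-%2) ⟩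
  sumℤ (-1^_ ∘ (_% 2)) xs       ≡⟨ sym (sumℤ-map -1^_ (_% 2) xs) ⟩
  sumℤ -1^_ (map (_% 2) xs)     ≡⟨ sumℤ-↭ -1^_ p ⟩
  sumℤ -1^_ (map (_% 2) ys)     ≡⟨ sumℤ-map -1^_ (_% 2) ys ⟩
  sumℤ (-1^_ ∘ (_% 2)) ys       ≡⟨ sumℤ-cong ys -1^-%2 ⟩
  sumℤ -1^_ ys                  ∎
  where open ≡-Reasoning

length-tree-cong : ∀ {M N} l → length M ≡ length N → length (tree M l) ≡ length (tree N l)
length-tree-cong {M} {N} l |M|≡|N| =
  trans (length-tree l M) (trans (cong (λ n → treeSize n l) |M|≡|N|) (sym (length-tree l N)))

∼⇒≡ : ∀ {s M N} → M ∼[ s ] N → s M ≡ s N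
∼⇒≡ M∼N = sym (∷-injectiveˡ (↭-singleton-inv (↭-sym (M∼N 0))))

module _ (s : Matching → ℕ) {M N : Matching} where

  private
    signed : Matching → ℕ → ℤ
    signed P l = sumℤ (-1^_ ∘ s) (tree P l)

  signedSums⇒∼ : length M ≡ length N → (∀ l → signed M l ≡ signed N l) → M ∼[ (λ v → s v % 2) ] N
  signedSums⇒∼ |M|≡|N| sums l =
    subst₂ _↭_ (sym (map-∘ (tree M l))) (sym (map-∘ (tree N l)))
      (parities-↭ (map s (tree M l)) (map s (tree N l)) lengths signs)
    where
    lengths = trans (length-map s (tree M l)) (trans (length-tree-cong l |M|≡|N|) (sym (length-map s (tree N l))))
    signs = trans (sumℤ-map -1^_ s (tree M l)) (trans (sums l) (sym (sumℤ-map -1^_ s (tree N l))))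

  ∼⇒signedSums : M ∼[ (λ v → s v % 2) ] N → ∀ l → signed M l ≡ signed N l
  ∼⇒signedSums M∼N l = begin
    sumℤ (-1^_ ∘ s) (tree M l)                ≡⟨ sym (sumℤ-map -1^_ s (tree M l)) ⟩
    sumℤ -1^_ (map s (tree M l))              ≡⟨ ↭-parities⇒sumℤ _ _ parities ⟩
    sumℤ -1^_ (map s (tree N l))              ≡⟨ sumℤ-map -1^_ s (tree N l) ⟩
    sumℤ (-1^_ ∘ s) (tree N l)                ∎
    where
    open ≡-Reasoning
    parities = subst₂ _↭_ (map-∘ (tree M l)) (map-∘ (tree N l)) (M∼N l)

balanced-cr₂-≡⇒∼ : ∀ {M N} → Balanced M → Balanced N → length M ≡ length N → cr₂ M ≡ cr₂ N → M ∼[ cr₂ ] N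
balanced-cr₂-≡⇒∼ {M} {N} balM balN |M|≡|N| cr₂≡ = signedSums⇒∼ cr |M|≡|N| λ l →
  trans (sumℤ-tree-cr l M balM) (trans (%2-≡⇒-1^-≡ (cr M) (cr N) cr₂≡) (sym (sumℤ-tree-cr l N balN)))

ne₂-balance-≡⇒∼ : ∀ {M N} → length M ≡ length N → ne₂ M ≡ ne₂ N → nestingBalance M ≡ nestingBalance N → M ∼[ ne₂ ] N
ne₂-balance-≡⇒∼ {M} {N} |M|≡|N| ne₂≡ balance≡ = signedSums⇒∼ ne |M|≡|N| sums
  where
  sign≡ = %2-≡⇒-1^-≡ (ne M) (ne N) ne₂≡
  sums : ∀ l → sumℤ (-1^_ ∘ ne) (tree M l) ≡ sumℤ (-1^_ ∘ ne) (tree N l)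
  sums zero    = cong (ℤ._+ 0ℤ) sign≡
  sums (suc l) = trans (sumℤ-tree-ne l M) (trans (cong₂ ℤ._*_ sign≡ balance≡) (sym (sumℤ-tree-ne l N)))

∼⇒ne₂-balance-≡ : ∀ {M N} → M ∼[ ne₂ ] N → ne₂ M ≡ ne₂ N × nestingBalance M ≡ nestingBalance N
∼⇒ne₂-balance-≡ {M} {N} M∼N = ∼⇒≡ M∼N , -1^-*-cancel (ne M) balance-times-sign
  where
  σ = -1^ ne M
  σ≡ : σ ≡ -1^ ne N
  σ≡ = %2-≡⇒-1^-≡ (ne M) (ne N) (∼⇒≡ M∼N)
  balance-times-sign : σ ℤ.* nestingBalance M ≡ σ ℤ.* nestingBalance N
  balance-times-sign = trans (sym (sumℤ-tree-ne 0 M))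
    (trans (∼⇒signedSums ne M∼N 1) (trans (sumℤ-tree-ne 0 N) (cong (ℤ._* nestingBalance N) (sym σ≡))))

relabel-≢ : ∀ x y → relabel x y ≢ x
relabel-≢ x y eq with relabelView x y
... | below p e = <⇒≢ p (trans (sym e) eq)
... | above p e = <⇒≢ (s≤s p) (sym (trans (sym e) eq))

suc-≤-relabel : ∀ x y → suc y ≤ relabel x y
suc-≤-relabel x y with relabelView x y
... | below _ e = ≤-reflexive (sym e)
... | above _ e = subst (suc y ≤_) (sym e) (n≤1+n (suc y))

relabel-≤ : ∀ x {y m} → y ≤ m → relabel x y ≤ 2 + m
relabel-≤ x {y} y≤m with relabelView x y
... | below _ e rewrite e = m≤n⇒m≤1+n (s≤s y≤m)
... | above _ e rewrite e = s≤s (s≤s y≤m)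

relabel-≤-cancel : ∀ x {y m} → x ≤ 2 + m → relabel x y ≤ 2 + m → y ≤ m
relabel-≤-cancel x {y} x≤ r≤ with relabelView x y
... | below p _ = ≤-pred (≤-pred (≤-trans p x≤))
... | above _ e = ≤-pred (≤-pred (subst (_≤ 2 + _) e r≤))

unrelabel : ℕ → ℕ → ℕ
unrelabel x i = if i <ᵇ x then i ∸ 1 else i ∸ 2

relabel-unrelabel : ∀ x i → 2 ≤ i → i ≢ x → relabel x (unrelabel x i) ≡ i
relabel-unrelabel x i@(suc (suc j)) (s≤s (s≤s z≤n)) i≢x with <-cmp i x
... | tri< i<x _ _ rewrite <ᵇ-true i<x = relabel-below i<x
... | tri≈ _ i≡x _ = ⊥-elim (i≢x i≡x)
... | tri> _ _ x<i rewrite <ᵇ-false (<⇒≤ x<i) = relabel-above (≤-pred x<i)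

unrelabel-relabel : ∀ x y → unrelabel x (relabel x y) ≡ y
unrelabel-relabel x y with relabelView x y
... | below p e rewrite e | <ᵇ-true p = refl
... | above p e rewrite e | <ᵇ-false (m≤n⇒m≤1+n p) = refl

relabel-onto : ∀ {x m i} → 2 ≤ x → x ≤ 2 + m → 2 ≤ i → i ≤ 2 + m → i ≢ x →
  Σ ℕ λ y → 1 ≤ y × y ≤ m × relabel x y ≡ i
relabel-onto {x} {m} {i} 2≤x x≤ 2≤i i≤ i≢x = y , 1≤y , relabel-≤-cancel x x≤ (subst (_≤ 2 + m) (sym r≡i) i≤) , r≡i
  where
  y = unrelabel x i
  r≡i = relabel-unrelabel x i 2≤i i≢x
  1≤y : 1 ≤ y
  1≤y with y in y≡
  ... | suc _ = s≤s z≤n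
  ... | zero  = ⊥-elim (<⇒≱ 2≤i (subst (_≤ 1) r≡i (subst (λ z → relabel x z ≤ 1) (sym y≡) (≤-reflexive (relabel-below 2≤x)))))

at-map : ∀ (f : ℕ → ℕ) xs i → 1 ≤ i → i ≤ length xs → at (map f xs) i ≡ f (at xs i)
at-map f (x ∷ xs) (suc zero)    _ _       = refl
at-map f (x ∷ xs) (suc (suc i)) _ (s≤s i≤) = at-map f xs (suc i) (s≤s z≤n) i≤

at-insertAt-below : ∀ k (a : ℕ) xs i → 1 ≤ i → i ≤ k → i ≤ length xs → at (insertAt k a xs) i ≡ at xs i
at-insertAt-below (suc k) a (y ∷ ys) (suc zero)    _ _        _        = refl
at-insertAt-below (suc k) a (y ∷ ys) (suc (suc i)) _ (s≤s i≤k) (s≤s i≤) = at-insertAt-below k a ys (suc i) (s≤s z≤n) i≤k i≤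

at-insertAt : ∀ k (a : ℕ) xs → k ≤ length xs → at (insertAt k a xs) (suc k) ≡ a
at-insertAt zero    a xs       _        = refl
at-insertAt (suc k) a (y ∷ ys) (s≤s k≤) = at-insertAt k a ys k≤

at-insertAt-above : ∀ k (a : ℕ) xs i → k < i → at (insertAt k a xs) (suc i) ≡ at xs i
at-insertAt-above zero    a xs       (suc i)       _         = refl
at-insertAt-above (suc k) a []       (suc zero)    (s≤s ())
at-insertAt-above (suc k) a []       (suc (suc i)) _         = refl
at-insertAt-above (suc k) a (y ∷ ys) (suc (suc i)) (s≤s k<i) = at-insertAt-above k a ys (suc i) k<i

at-applyUpTo : ∀ (f : ℕ → ℕ) m j → 1 ≤ j → j ≤ m → at (applyUpTo f m) j ≡ f (j ∸ 1)
at-applyUpTo f (suc m) (suc zero)    _ _        = refl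
at-applyUpTo f (suc m) (suc (suc j)) _ (s≤s j≤) = at-applyUpTo (f ∘ suc) m (suc j) (s≤s z≤n) j≤

at-ext : ∀ (xs ys : List ℕ) → length xs ≡ length ys → (∀ i → 1 ≤ i → i ≤ length xs → at xs i ≡ at ys i) → xs ≡ ys
at-ext []       []       _  _  = refl
at-ext (x ∷ xs) (y ∷ ys) eq at≡ = cong₂ _∷_ (at≡ 1 (s≤s z≤n) (s≤s z≤n))
  (at-ext xs ys (suc-injective eq) λ { (suc i) _ i≤ → at≡ (suc (suc i)) (s≤s z≤n) (s≤s i≤) })

module _ (v : Matching) (k : ℕ) (k≤ : k ≤ length v) where

  private
    x = 2 + k

  at-child-new : at (child v x) x ≡ 1
  at-child-new = at-insertAt k 1 (map (relabel x) v) (subst (k ≤_) (sym (length-map (relabel x) v)) k≤)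

  at-child-relabel : ∀ y → 1 ≤ y → y ≤ length v → at (child v x) (relabel x y) ≡ relabel x (at v y)
  at-child-relabel (suc y) 1≤y y≤ with relabelView x (suc y)
  ... | below p e rewrite e =
    trans (at-insertAt-below k 1 _ (suc y) 1≤y (≤-pred (≤-pred p)) (subst (suc y ≤_) (sym (length-map (relabel x) v)) y≤))
          (at-map (relabel x) v (suc y) 1≤y y≤)
  ... | above p e rewrite e =
    trans (at-insertAt-above k 1 _ (suc y) (≤-pred p)) (at-map (relabel x) v (suc y) 1≤y y≤)

MatchedAt : ℕ → Matching → ℕ → Set
MatchedAt n v i = 1 ≤ at v i × at v i ≤ 2 * n × at v i ≢ i × at v (at v i) ≡ i

2*-suc : ∀ n → 2 * suc n ≡ 2 + 2 * n
2*-suc n = *-suc 2 n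

IsMatching-child : ∀ {n v k} → IsMatching n v → k ≤ 2 * n → IsMatching (suc n) (child v (2 + k))
IsMatching-child {n} {v} {k} (|v| , matched) k≤ =
  trans (length-child v x) (trans (cong (2 +_) |v|) (sym (2*-suc n))) , matched'
  where
  x = 2 + k
  c = child v x
  k≤|v| = subst (k ≤_) (sym |v|) k≤
  x≤ : x ≤ 2 * suc n
  x≤ = subst (x ≤_) (sym (2*-suc n)) (s≤s (s≤s k≤))
  matched-relabel : ∀ y → 1 ≤ y → y ≤ 2 * n → MatchedAt (suc n) c (relabel x y)
  matched-relabel y 1≤y y≤ rewrite at-child-relabel v k k≤|v| y 1≤y (subst (y ≤_) (sym |v|) y≤) =
    relabel-positive x w ,
    subst (relabel x w ≤_) (sym (2*-suc n)) (relabel-≤ x w≤) ,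
    (λ eq → w≢y (relabel-injective x eq)) ,
    trans (at-child-relabel v k k≤|v| w 1≤w (subst (w ≤_) (sym |v|) w≤)) (cong (relabel x) vw≡y)
    where
    w = at v y
    m = matched y 1≤y y≤
    1≤w = proj₁ m
    w≤ = proj₁ (proj₂ m)
    w≢y = proj₁ (proj₂ (proj₂ m))
    vw≡y = proj₂ (proj₂ (proj₂ m))
  matched' : ∀ i → 1 ≤ i → i ≤ 2 * suc n → MatchedAt (suc n) c i
  matched' (suc zero) _ _ = s≤s z≤n , x≤ , (λ ()) , at-child-new v k k≤|v|
  matched' i@(suc (suc _)) _ i≤ with i ≟ x
  ... | yes refl rewrite at-child-new v k k≤|v| = ≤-refl , subst (1 ≤_) (sym (2*-suc n)) (s≤s z≤n) , (λ ()) , refl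
  ... | no i≢x =
    let (y , 1≤y , y≤ , r≡i) = relabel-onto (s≤s (s≤s z≤n)) (s≤s (s≤s k≤)) (s≤s (s≤s z≤n)) (subst (i ≤_) (2*-suc n) i≤) i≢x
    in subst (MatchedAt (suc n) c) r≡i (matched-relabel y 1≤y y≤)

matchedAt-1 : ∀ {n N} → IsMatching (suc n) N → MatchedAt (suc n) N 1
matchedAt-1 {n} (_ , matched) = matched 1 (s≤s z≤n) (subst (1 ≤_) (sym (2*-suc n)) (s≤s z≤n))

-- The parent of a matching N with N 1 = x = 2 + k: delete vertices 1 and x.
module Parent {n k t} (isM : IsMatching (suc n) (2 + k ∷ t)) where

  private
    N = 2 + k ∷ t
    x = 2 + k
    matched = proj₂ isM
    up : ∀ {i} → i ≤ 2 + 2 * n → i ≤ 2 * suc n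
    up {i} = subst (i ≤_) (sym (2*-suc n))
    down : ∀ {i} → i ≤ 2 * suc n → i ≤ 2 + 2 * n
    down {i} = subst (i ≤_) (2*-suc n)

  k≤ : k ≤ 2 * n
  k≤ = ≤-pred (≤-pred (down (proj₁ (proj₂ (matchedAt-1 isM)))))

  N-x : at N x ≡ 1
  N-x = proj₂ (proj₂ (proj₂ (matchedAt-1 isM)))

  partner : ∀ y → 1 ≤ y → y ≤ 2 * n →
    MatchedAt (suc n) N (relabel x y) × 2 ≤ at N (relabel x y) × at N (relabel x y) ≢ x
  partner y 1≤y y≤ = m , 2≤z , z≢x
    where
    i = relabel x y
    m = matched i (relabel-positive x y) (up (relabel-≤ x y≤))
    back = proj₂ (proj₂ (proj₂ m))
    z≢x : at N i ≢ x
    z≢x z≡x = <⇒≱ (≤-trans (s≤s 1≤y) (suc-≤-relabel x y)) (≤-reflexive (trans (sym back) (trans (cong (at N) z≡x) N-x)))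
    2≤z : 2 ≤ at N i
    2≤z with at N i in z≡ | proj₁ m
    ... | suc (suc _) | _ = s≤s (s≤s z≤n)
    ... | suc zero    | _ = ⊥-elim (relabel-≢ x y (trans (sym back) (cong (at N) z≡)))

  parentAt : ℕ → ℕ
  parentAt y = unrelabel x (at N (relabel x y))

  parent : Matching
  parent = map parentAt (applyUpTo suc (2 * n))

  length-parent : length parent ≡ 2 * n
  length-parent = trans (length-map parentAt (applyUpTo suc (2 * n))) (length-applyUpTo suc (2 * n))

  at-parent : ∀ y → 1 ≤ y → y ≤ 2 * n → at parent y ≡ parentAt y
  at-parent y@(suc _) 1≤y y≤ =
    trans (at-map parentAt (applyUpTo suc (2 * n)) y 1≤y (subst (y ≤_) (sym (length-applyUpTo suc (2 * n))) y≤))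
          (cong parentAt (at-applyUpTo suc (2 * n) y 1≤y y≤))

  relabel-parentAt : ∀ y → 1 ≤ y → y ≤ 2 * n → relabel x (parentAt y) ≡ at N (relabel x y)
  relabel-parentAt y 1≤y y≤ = let (_ , 2≤z , z≢x) = partner y 1≤y y≤ in relabel-unrelabel x _ 2≤z z≢x

  parent-IsMatching : IsMatching n parent
  parent-IsMatching = length-parent , matched-parent
    where
    matched-parent : ∀ y → 1 ≤ y → y ≤ 2 * n → MatchedAt n parent y
    matched-parent y 1≤y y≤ rewrite at-parent y 1≤y y≤ = 1≤w , w≤ , w≢y , vw≡y
      where
      p = partner y 1≤y y≤
      m = proj₁ p
      onto = relabel-onto (s≤s (s≤s z≤n)) (s≤s (s≤s k≤)) (proj₁ (proj₂ p)) (down (proj₁ (proj₂ m))) (proj₂ (proj₂ p))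
      w = parentAt y
      1≤w = proj₁ (proj₂ onto)
      w≤ = proj₁ (proj₂ (proj₂ onto))
      w≢y : w ≢ y
      w≢y w≡y = proj₁ (proj₂ (proj₂ m)) (trans (sym (relabel-parentAt y 1≤y y≤)) (cong (relabel x) w≡y))
      vw≡y : at parent w ≡ y
      vw≡y = begin
        at parent w                             ≡⟨ at-parent w 1≤w w≤ ⟩
        unrelabel x (at N (relabel x w))        ≡⟨ cong (unrelabel x ∘ at N) (relabel-parentAt y 1≤y y≤) ⟩
        unrelabel x (at N (at N (relabel x y))) ≡⟨ cong (unrelabel x) (proj₂ (proj₂ (proj₂ m))) ⟩
        unrelabel x (relabel x y)               ≡⟨ unrelabel-relabel x y ⟩
        y                                       ∎
        where open ≡-Reasoning

  child-parent : child parent x ≡ N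
  child-parent = at-ext (child parent x) N
    (trans (length-child parent x) (trans (cong (2 +_) length-parent) (sym (trans (proj₁ isM) (2*-suc n))))) pointwise
    where
    k≤|v| = subst (k ≤_) (sym length-parent) k≤
    pointwise : ∀ i → 1 ≤ i → i ≤ length (child parent x) → at (child parent x) i ≡ at N i
    pointwise (suc zero) _ _ = refl
    pointwise i@(suc (suc _)) _ i≤ with i ≟ x
    ... | yes refl = trans (at-child-new parent k k≤|v|) (sym N-x)
    ... | no i≢x =
      let (y , 1≤y , y≤ , r≡i) = relabel-onto (s≤s (s≤s z≤n)) (s≤s (s≤s k≤)) (s≤s (s≤s z≤n))
                                   (subst (i ≤_) (trans (length-child parent x) (cong (2 +_) length-parent)) i≤) i≢x
      in subst (λ j → at (child parent x) j ≡ at N j) r≡i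
           (trans (at-child-relabel parent k k≤|v| y 1≤y (subst (y ≤_) (sym length-parent) y≤))
                  (trans (cong (relabel x) (at-parent y 1≤y y≤)) (relabel-parentAt y 1≤y y≤)))

decompose : ∀ {n} N → IsMatching (suc n) N →
  Σ Matching λ v → Σ ℕ λ k → k ≤ 2 * n × IsMatching n v × child v (2 + k) ≡ N
decompose []                 (() , _)
decompose (zero ∷ t)         isM with () ← proj₁ (matchedAt-1 isM)
decompose (suc zero ∷ t)     isM = ⊥-elim (proj₁ (proj₂ (proj₂ (matchedAt-1 isM))) refl)
decompose (suc (suc k) ∷ t)  isM = parent , k , k≤ , parent-IsMatching , child-parent
  where open Parent isM

matchings : ℕ → List Matching
matchings = tree []

∈-matchings-suc⁻ : ∀ n {N} → N ∈ matchings (suc n) →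
  Σ Matching λ v → Σ ℕ λ k → v ∈ matchings n × k ≤ length v × N ≡ child v (2 + k)
∈-matchings-suc⁻ n N∈ with find (∈-concatMap⁻ children {xs = matchings n} N∈)
... | v , v∈ , N∈children with ∈-map⁻ (λ k → child v (2 + k)) N∈children
...   | k , k∈ , N≡ = v , k , v∈ , ≤-pred (∈-upTo⁻ k∈) , N≡

child-∈-matchings : ∀ n {v} k → v ∈ matchings n → k ≤ length v → child v (2 + k) ∈ matchings (suc n)
child-∈-matchings n {v} k v∈ k≤ = ∈-concatMap⁺ children {xs = matchings n}
  (Any.map (λ { refl → ∈-map⁺ (λ k → child v (2 + k)) (∈-upTo⁺ (s≤s k≤)) }) v∈)

matchings-induction : (P : ℕ → Matching → Set) → P 0 [] →
  (∀ {n v k} → P n v → k ≤ length v → P (suc n) (child v (2 + k))) →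
  ∀ n {N} → N ∈ matchings n → P n N
matchings-induction P base step zero    (here refl) = base
matchings-induction P base step (suc n) N∈ with ∈-matchings-suc⁻ n N∈
... | v , k , v∈ , k≤ , refl = step (matchings-induction P base step n v∈) k≤

∈-matchings⇒IsMatching : ∀ n {N} → N ∈ matchings n → IsMatching n N
∈-matchings⇒IsMatching = matchings-induction IsMatching (refl , λ { zero () _ ; (suc _) _ () })
  λ isM k≤ → IsMatching-child isM (subst (_ ≤_) (proj₁ isM) k≤)

IsMatching⇒∈-matchings : ∀ n {N} → IsMatching n N → N ∈ matchings n
IsMatching⇒∈-matchings zero    {[]}    _       = here refl
IsMatching⇒∈-matchings zero    {_ ∷ _} (() , _)
IsMatching⇒∈-matchings (suc n) {N}     isM with decompose N isM
... | v , k , k≤ , isM-v , refl =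
  child-∈-matchings n k (IsMatching⇒∈-matchings n isM-v) (subst (k ≤_) (sym (proj₁ isM-v)) k≤)

length-∈-matchings : ∀ n {N} → N ∈ matchings n → length N ≡ 2 * n
length-∈-matchings n = proj₁ ∘ ∈-matchings⇒IsMatching n

Balanced-[] : Balanced []
Balanced-[] = (0 , refl) , λ { zero _ → refl }

∈-matchings⇒Balanced : ∀ n {N} → N ∈ matchings n → Balanced N
∈-matchings⇒Balanced = matchings-induction (λ _ → Balanced) Balanced-[]
  λ {_} {v} {k} bal k≤ → Balanced-child v k bal k≤

insertAt-injective : ∀ k (a : ℕ) {xs ys} → insertAt k a xs ≡ insertAt k a ys → xs ≡ ys
insertAt-injective zero    a eq = ∷-injectiveʳ eq
insertAt-injective (suc k) a {[]}     {[]}     eq = refl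
insertAt-injective (suc k) a {[]}     {y ∷ ys} eq with () ← trans (cong length (∷-injectiveʳ eq)) (length-insertAt k a ys)
insertAt-injective (suc k) a {x ∷ xs} {[]}     eq with () ← trans (cong length (sym (∷-injectiveʳ eq))) (length-insertAt k a xs)
insertAt-injective (suc k) a {x ∷ xs} {y ∷ ys} eq =
  cong₂ _∷_ (∷-injectiveˡ eq) (insertAt-injective k a (∷-injectiveʳ eq))

child-injective : ∀ {v w x y} → child v x ≡ child w y → x ≡ y × v ≡ w
child-injective {x = x} eq with ∷-injectiveˡ eq
... | refl = refl , map-injective (relabel-injective x) (insertAt-injective (x ∸ 2) 1 (∷-injectiveʳ eq))

children-unique : ∀ v → Unique (children v)
children-unique v = Uniqueᴾ.map⁺ (λ eq → suc-injective (suc-injective (proj₁ (child-injective eq)))) (Uniqueᴾ.upTo⁺ (suc (length v)))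

children-disjoint : ∀ {v w} → v ≢ w → Disjoint (children v) (children w)
children-disjoint {v} {w} v≢w (N∈v , N∈w) with ∈-map⁻ (λ k → child v (2 + k)) N∈v | ∈-map⁻ (λ k → child w (2 + k)) N∈w
... | _ , _ , refl | _ , _ , eq = v≢w (proj₂ (child-injective eq))

matchings-unique : ∀ n → Unique (matchings n)
matchings-unique zero    = [] ∷ []
matchings-unique (suc n) = Uniqueᴾ.concat⁺
  (Allᴾ.map⁺ (All.universal children-unique (matchings n)))
  (AllPairsᴾ.map⁺ (AllPairs.map children-disjoint (matchings-unique n)))

length-matchings : ∀ n → length (matchings n) ≡ n !!
length-matchings zero    = refl
length-matchings (suc n) = begin
  length (concatMap children (matchings n))  ≡⟨ length-concatMap children (suc (2 * n)) (matchings n) (All.tabulate childCount) ⟩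
  length (matchings n) * suc (2 * n)        ≡⟨ cong (_* suc (2 * n)) (length-matchings n) ⟩
  (n !!) * suc (2 * n)                      ≡⟨ *-comm (n !!) (suc (2 * n)) ⟩
  suc (2 * n) * (n !!)                      ≡⟨ cong (_* (n !!)) (+-comm 1 (2 * n)) ⟩
  (2 * n + 1) * (n !!)                      ∎
  where
  open ≡-Reasoning
  childCount : ∀ {v} → v ∈ matchings n → length (children v) ≡ suc (2 * n)
  childCount {v} v∈ = trans (length-map _ (upTo (suc (length v))))
    (trans (length-applyUpTo (λ k → k) (suc (length v))) (cong suc (length-∈-matchings n v∈)))

isOdd : ℕ → Bool
isOdd zero    = false
isOdd (suc n) = not (isOdd n)

oddCount : ℕ → (ℕ → ℕ) → ℕ
oddCount zero    g = 0
oddCount (suc L) g = indicator (isOdd (g 0)) + oddCount L (g ∘ suc)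

oddCount-cong : ∀ L {g h} → (∀ j → j < L → g j ≡ h j) → oddCount L g ≡ oddCount L h
oddCount-cong zero    g≗h = refl
oddCount-cong (suc L) g≗h =
  cong₂ _+_ (cong (indicator ∘ isOdd) (g≗h 0 z<s)) (oddCount-cong L (λ j j< → g≗h (suc j) (s≤s j<)))

oddCount-snoc : ∀ L g → oddCount (suc L) g ≡ oddCount L g + indicator (isOdd (g L))
oddCount-snoc zero    g = +-comm (indicator (isOdd (g 0))) 0
oddCount-snoc (suc L) g =
  trans (cong (indicator (isOdd (g 0)) +_) (oddCount-snoc L (g ∘ suc))) (sym (+-assoc (indicator (isOdd (g 0))) _ _))

oddCount+evenCount : ∀ L g → oddCount L g + oddCount L (suc ∘ g) ≡ L
oddCount+evenCount zero    g = refl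
oddCount+evenCount (suc L) g = begin
  (o + rest) + (e + rest')  ≡⟨ +-interchange o rest e rest' ⟩
  (o + e) + (rest + rest')  ≡⟨ cong₂ _+_ (one (isOdd (g 0))) (oddCount+evenCount L (g ∘ suc)) ⟩
  suc L                     ∎
  where
  open ≡-Reasoning
  o = indicator (isOdd (g 0))
  e = indicator (not (isOdd (g 0)))
  rest = oddCount L (g ∘ suc)
  rest' = oddCount L (suc ∘ g ∘ suc)
  one : ∀ b → indicator b + indicator (not b) ≡ 1
  one true  = refl
  one false = refl

-1^-isOdd : ∀ n → -1^ n ≡ (if isOdd n then -1ℤ else 1ℤ)
-1^-isOdd zero = refl
-1^-isOdd (suc n) rewrite -1^-isOdd n with isOdd n
... | true  = refl
... | false = refl

-1^+2isOdd : ∀ n → -1^ n ℤ.+ ℤ.+ (indicator (isOdd n) + indicator (isOdd n)) ≡ 1ℤ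
-1^+2isOdd n rewrite -1^-isOdd n with isOdd n
... | true  = refl
... | false = refl

∑-sign+2oddCount : ∀ L g → ∑ L (-1^_ ∘ g) ℤ.+ ℤ.+ (oddCount L g + oddCount L g) ≡ ℤ.+ L
∑-sign+2oddCount zero    g = refl
∑-sign+2oddCount (suc L) g = begin
  (s ℤ.+ S) ℤ.+ ℤ.+ ((i + o) + (i + o))        ≡⟨ cong (λ n → (s ℤ.+ S) ℤ.+ ℤ.+ n) (+-interchange i o i o) ⟩
  (s ℤ.+ S) ℤ.+ ℤ.+ ((i + i) + (o + o))        ≡⟨ cong (ℤ._+_ (s ℤ.+ S)) (ℤ.pos-+ (i + i) (o + o)) ⟩
  (s ℤ.+ S) ℤ.+ (ℤ.+ (i + i) ℤ.+ ℤ.+ (o + o))  ≡⟨ solve 4 (λ a b c d → (a :+ b) :+ (c :+ d) := (a :+ c) :+ (b :+ d)) refl s S (ℤ.+ (i + i)) (ℤ.+ (o + o)) ⟩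
  (s ℤ.+ ℤ.+ (i + i)) ℤ.+ (S ℤ.+ ℤ.+ (o + o))  ≡⟨ cong₂ ℤ._+_ (-1^+2isOdd (g 0)) (∑-sign+2oddCount L (g ∘ suc)) ⟩
  ℤ.+ suc L                                      ∎
  where
  open ≡-Reasoning
  s = -1^ g 0
  S = ∑ L (-1^_ ∘ g ∘ suc)
  i = indicator (isOdd (g 0))
  o = oddCount L (g ∘ suc)

oddClosed : Matching → ℕ
oddClosed v = oddCount (suc (length v)) (closedBy (edges v))

ℤ-+-cancelʳ : ∀ {a b c} → a ℤ.+ c ≡ b ℤ.+ c → a ≡ b
ℤ-+-cancelʳ {a} {b} {c} e = begin
  a                     ≡⟨ solve 2 (λ a c → a := (a :+ c) :- c) refl a c ⟩
  (a ℤ.+ c) ℤ.- c       ≡⟨ cong (ℤ._- c) e ⟩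
  (b ℤ.+ c) ℤ.- c       ≡⟨ solve 2 (λ b c → (b :+ c) :- c := b) refl b c ⟩
  b                     ∎
  where open ≡-Reasoning

module _ {M N : Matching} (|M|≡|N| : length M ≡ length N) where

  private
    balanced : ∀ v → nestingBalance v ℤ.+ ℤ.+ (oddClosed v + oddClosed v) ≡ ℤ.+ suc (length v)
    balanced v = ∑-sign+2oddCount (suc (length v)) (closedBy (edges v))
    total : nestingBalance M ℤ.+ ℤ.+ (oddClosed M + oddClosed M) ≡ nestingBalance N ℤ.+ ℤ.+ (oddClosed N + oddClosed N)
    total = trans (balanced M) (trans (cong (λ n → ℤ.+ suc n) |M|≡|N|) (sym (balanced N)))

  nestingBalance-≡⇒oddClosed-≡ : nestingBalance M ≡ nestingBalance N → oddClosed M ≡ oddClosed N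
  nestingBalance-≡⇒oddClosed-≡ b≡ = +-cancel-double (ℤ.+-injective (ℤ-+-cancelʳ {c = nestingBalance N} (begin
    ℤ.+ (oddClosed M + oddClosed M) ℤ.+ nestingBalance N  ≡⟨ ℤ.+-comm _ (nestingBalance N) ⟩
    nestingBalance N ℤ.+ ℤ.+ (oddClosed M + oddClosed M)  ≡⟨ cong (ℤ._+ ℤ.+ (oddClosed M + oddClosed M)) (sym b≡) ⟩
    nestingBalance M ℤ.+ ℤ.+ (oddClosed M + oddClosed M)  ≡⟨ total ⟩
    nestingBalance N ℤ.+ ℤ.+ (oddClosed N + oddClosed N)  ≡⟨ ℤ.+-comm (nestingBalance N) _ ⟩
    ℤ.+ (oddClosed N + oddClosed N) ℤ.+ nestingBalance N  ∎)))
    where open ≡-Reasoning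

  oddClosed-≡⇒nestingBalance-≡ : oddClosed M ≡ oddClosed N → nestingBalance M ≡ nestingBalance N
  oddClosed-≡⇒nestingBalance-≡ o≡ = ℤ-+-cancelʳ (trans total (cong (λ o → nestingBalance N ℤ.+ ℤ.+ (o + o)) (sym o≡)))

UnitSteps : (ℕ → ℕ) → Set
UnitSteps g = ∀ j → g (suc j) ≡ g j ⊎ g (suc j) ≡ suc (g j)

Staircase : ℕ → Matching → Set
Staircase n v = let g = closedBy (edges v) in
  g 0 ≡ 0 × g 1 ≡ 0 × UnitSteps g × g (length v) ≡ n

Staircase-child : ∀ {n v k} → Staircase n v → k ≤ length v → Staircase (suc n) (child v (2 + k))
Staircase-child {n} {v} {k} (g0 , g1 , steps , gL) k≤ =
  closedBy-zero c , trans (closedBy-child-below v k 0 z≤n) g0 , steps' ,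
  trans (cong g' (length-child v (2 + k))) (trans (closedBy-child-above v k (length v) k≤) (cong suc gL))
  where
  c = child v (2 + k)
  g' = closedBy (edges c)
  steps' : UnitSteps g'
  steps' zero = inj₁ (trans (closedBy-child-below v k 0 z≤n) (trans g0 (sym (closedBy-zero c))))
  steps' (suc j) with <-cmp j k
  ... | tri< j<k _ _ rewrite closedBy-child-below v k (suc j) j<k | closedBy-child-below v k j (<⇒≤ j<k) = steps j
  ... | tri≈ _ refl _ rewrite closedBy-child-above v k k ≤-refl | closedBy-child-below v k k ≤-refl = inj₂ refl
  steps' (suc (suc j)) | tri> _ _ (s≤s k≤j)
    rewrite closedBy-child-above v k (suc j) (m≤n⇒m≤1+n k≤j) | closedBy-child-above v k j k≤j with steps j
  ... | inj₁ e = inj₁ (cong suc e)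
  ... | inj₂ e = inj₂ (cong suc e)

∈-matchings⇒Staircase : ∀ n {N} → N ∈ matchings n → Staircase n N
∈-matchings⇒Staircase = matchings-induction Staircase (refl , refl , (λ _ → inj₁ refl) , refl) Staircase-child

⌈suc/2⌉ : ∀ m → ⌈ suc m /2⌉ ≡ ⌈ m /2⌉ + indicator (isOdd (suc m))
⌈suc/2⌉ zero          = refl
⌈suc/2⌉ (suc zero)    = refl
⌈suc/2⌉ (suc (suc m)) rewrite not-involutive (isOdd (suc m)) = cong suc (⌈suc/2⌉ m)

⌊suc/2⌋ : ∀ m → ⌊ suc m /2⌋ ≡ ⌊ m /2⌋ + indicator (isOdd (2 + m))
⌊suc/2⌋ zero          = refl
⌊suc/2⌋ (suc zero)    = refl
⌊suc/2⌋ (suc (suc m)) rewrite not-involutive (isOdd (2 + m)) = cong suc (⌊suc/2⌋ m)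

-- Every odd (resp. even) value up to g L is taken, and 0 is taken twice.
⌈/2⌉≤oddCount : ∀ {g} → g 0 ≡ 0 → UnitSteps g → ∀ L → ⌈ g L /2⌉ ≤ oddCount (suc L) g
⌈/2⌉≤oddCount {g} g0 steps zero rewrite g0 = z≤n
⌈/2⌉≤oddCount {g} g0 steps (suc L) rewrite oddCount-snoc (suc L) g with steps L
... | inj₁ e rewrite e = ≤-trans (⌈/2⌉≤oddCount g0 steps L) (m≤m+n _ _)
... | inj₂ e rewrite e | ⌈suc/2⌉ (g L) = +-monoˡ-≤ _ (⌈/2⌉≤oddCount g0 steps L)

2+⌊/2⌋≤evenCount : ∀ {g} → g 0 ≡ 0 → g 1 ≡ 0 → UnitSteps g → ∀ L → 2 + ⌊ g (suc L) /2⌋ ≤ oddCount (2 + L) (suc ∘ g)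
2+⌊/2⌋≤evenCount {g} g0 g1 steps zero rewrite g0 | g1 = ≤-refl
2+⌊/2⌋≤evenCount {g} g0 g1 steps (suc L) rewrite oddCount-snoc (2 + L) (suc ∘ g) with steps (suc L)
... | inj₁ e rewrite e = ≤-trans (2+⌊/2⌋≤evenCount g0 g1 steps L) (m≤m+n _ _)
... | inj₂ e rewrite e | ⌊suc/2⌋ (g (suc L)) = +-monoˡ-≤ _ (2+⌊/2⌋≤evenCount g0 g1 steps L)

oddClosed-range : ∀ n {N} → N ∈ matchings (suc n) → ⌈ suc n /2⌉ ≤ oddClosed N × oddClosed N < ⌈ suc n /2⌉ + suc n
oddClosed-range n {N} N∈ = lower , upper
  where
  s = suc n
  c = ⌈ s /2⌉
  g = closedBy (edges N)
  stair = ∈-matchings⇒Staircase (suc n) N∈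
  |N| : length N ≡ suc (suc (2 * n))
  |N| = trans (length-∈-matchings (suc n) N∈) (2*-suc n)
  gL : g (suc (suc (2 * n))) ≡ s
  gL = trans (cong g (sym |N|)) (proj₂ (proj₂ (proj₂ stair)))
  lower : c ≤ oddClosed N
  lower = subst₂ (λ a b → ⌈ a /2⌉ ≤ oddCount (suc b) g) gL (sym |N|)
            (⌈/2⌉≤oddCount (proj₁ stair) (proj₁ (proj₂ (proj₂ stair))) (suc (suc (2 * n))))
  evens : 2 + ⌊ s /2⌋ ≤ oddCount (suc (length N)) (suc ∘ g)
  evens = subst₂ (λ a b → 2 + ⌊ a /2⌋ ≤ oddCount (suc b) (suc ∘ g)) gL (sym |N|)
           (2+⌊/2⌋≤evenCount (proj₁ stair) (proj₁ (proj₂ stair)) (proj₁ (proj₂ (proj₂ stair))) (suc (2 * n)))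
  total : oddClosed N + oddCount (suc (length N)) (suc ∘ g) ≡ suc s + s
  total = trans (oddCount+evenCount (suc (length N)) g)
    (trans (cong suc |N|) (cong (2 +_) (trans (cong (suc ∘ (n +_)) (+-identityʳ n)) (sym (+-suc n n)))))
  upper : oddClosed N < c + s
  upper = +-cancelʳ-≤ (suc s) (suc (oddClosed N)) (c + s) (begin
    suc (oddClosed N) + suc s                 ≡⟨ cong (λ z → suc (oddClosed N) + suc z) (sym (⌊n/2⌋+⌈n/2⌉≡n s)) ⟩
    suc (oddClosed N) + suc (⌊ s /2⌋ + c)     ≡⟨ ℕ-solve 3 (λ o f c → ℕ-con 1 ⊕ o ⊕ (ℕ-con 1 ⊕ (f ⊕ c)) ⊜ o ⊕ (ℕ-con 2 ⊕ f) ⊕ c) refl (oddClosed N) ⌊ s /2⌋ c ⟩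
    oddClosed N + (2 + ⌊ s /2⌋) + c           ≤⟨ +-monoˡ-≤ c (+-monoʳ-≤ (oddClosed N) evens) ⟩
    oddClosed N + oddCount (suc (length N)) (suc ∘ g) + c ≡⟨ cong (_+ c) total ⟩
    suc s + s + c                             ≡⟨ ℕ-solve 2 (λ s c → ℕ-con 1 ⊕ s ⊕ s ⊕ c ⊜ c ⊕ s ⊕ (ℕ-con 1 ⊕ s)) refl s c ⟩
    c + s + suc s                             ∎)
    where open ≤-Reasoning

Realised : ℕ → ℕ → ℕ → Set
Realised n p o = Σ Matching λ M → M ∈ matchings n × ne₂ M ≡ p × oddClosed M ≡ o

realisedBy : ∀ {n} M {M∈ : True (M ∈? matchings n)} → Realised n (ne₂ M) (oddClosed M)
realisedBy M {M∈} = M , toWitness M∈ , refl , refl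

ne₂-child : ∀ v k → closedBy (edges v) k ≡ 0 → ne₂ (child v (2 + k)) ≡ ne₂ v
ne₂-child v k closed≡0 = cong (_% 2) (trans (ne-child v k) (trans (cong (ne v +_) closed≡0) (+-identityʳ (ne v))))

-- The child with new edge {1, 2} (resp. {1, 3}) shifts closedBy by one after
-- position 1 (resp. 2), turning the even values of v into its odd values.
oddClosed-child₂ : ∀ v → closedBy (edges v) 0 ≡ 0 → oddClosed (child v 2) ≡ oddCount (suc (length v)) (suc ∘ closedBy (edges v))
oddClosed-child₂ v g0 = begin
  oddCount (suc (length c)) g'
    ≡⟨ cong (λ L → oddCount (suc L) g') (length-child v 2) ⟩
  odd? (g' 0) + (odd? (g' 1) + rest)
    ≡⟨ cong₂ (λ a b → odd? a + (odd? b + rest)) (closedBy-zero c) (trans (closedBy-child-below v 0 0 z≤n) g0) ⟩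
  rest
    ≡⟨ oddCount-cong (suc (length v)) (λ j _ → closedBy-child-above v 0 j z≤n) ⟩
  oddCount (suc (length v)) (suc ∘ closedBy (edges v)) ∎
  where
  open ≡-Reasoning
  c = child v 2
  g' = closedBy (edges c)
  odd? = indicator ∘ isOdd
  rest = oddCount (suc (length v)) (g' ∘ (2 +_))

oddClosed-child₃ : ∀ v → closedBy (edges v) 0 ≡ 0 → closedBy (edges v) 1 ≡ 0 →
  suc (oddClosed (child v 3)) ≡ oddCount (suc (length v)) (suc ∘ closedBy (edges v))
oddClosed-child₃ v g0 g1 = begin
  suc (oddCount (suc (length c)) g')
    ≡⟨ cong (λ L → suc (oddCount (suc L) g')) (length-child v 3) ⟩
  suc (odd? (g' 0) + (odd? (g' 1) + (odd? (g' 2) + rest)))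
    ≡⟨ cong (λ a → suc (odd? a + (odd? (g' 1) + (odd? (g' 2) + rest)))) (closedBy-zero c) ⟩
  suc (odd? (g' 1) + (odd? (g' 2) + rest))
    ≡⟨ cong (λ a → suc (odd? a + (odd? (g' 2) + rest))) (trans (closedBy-child-below v 1 0 z≤n) g0) ⟩
  suc (odd? (g' 2) + rest)
    ≡⟨ cong (λ a → suc (odd? a + rest)) (trans (closedBy-child-below v 1 1 ≤-refl) g1) ⟩
  suc rest
    ≡⟨ cong₂ (λ a b → indicator (not (isOdd a)) + b) (sym g0) (oddCount-cong (length v) (λ j _ → closedBy-child-above v 1 (suc j) (s≤s z≤n))) ⟩
  oddCount (suc (length v)) (suc ∘ closedBy (edges v)) ∎
  where
  open ≡-Reasoning
  c = child v 3
  g' = closedBy (edges c)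
  odd? = indicator ∘ isOdd
  rest = oddCount (length v) (g' ∘ (3 +_))

oddClosed+evenClosed : ∀ n {M} → M ∈ matchings n →
  oddClosed M + oddCount (suc (length M)) (suc ∘ closedBy (edges M)) ≡ suc (2 * n)
oddClosed+evenClosed n {M} M∈ =
  trans (oddCount+evenCount (suc (length M)) (closedBy (edges M))) (cong suc (length-∈-matchings n M∈))

realised-child₂ : ∀ {n p o o'} → Realised n p o → o' + o ≡ suc (2 * n) → Realised (suc n) p o'
realised-child₂ {n} {p} {o} {o'} (M , M∈ , ne₂≡ , odd≡) sum≡ =
  child M 2 , child-∈-matchings n 0 M∈ z≤n , trans (ne₂-child M 0 g0) ne₂≡ , odd'
  where
  g0 = proj₁ (∈-matchings⇒Staircase n M∈)
  odd' : oddClosed (child M 2) ≡ o'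
  odd' = trans (oddClosed-child₂ M g0) (+-cancelˡ-≡ o _ o'
    (trans (cong (_+ _) (sym odd≡)) (trans (oddClosed+evenClosed n M∈) (trans (sym sum≡) (+-comm o' o)))))

realised-child₃ : ∀ {n p o o'} → Realised (suc n) p o → o' + o ≡ 2 * suc n → Realised (2 + n) p o'
realised-child₃ {n} {p} {o} {o'} (M , M∈ , ne₂≡ , odd≡) sum≡ =
  child M 3 , child-∈-matchings (suc n) 1 M∈ 1≤|M| , trans (ne₂-child M 1 g1) ne₂≡ , odd'
  where
  stair = ∈-matchings⇒Staircase (suc n) M∈
  g1 = proj₁ (proj₂ stair)
  1≤|M| = subst (1 ≤_) (sym (trans (length-∈-matchings (suc n) M∈) (2*-suc n))) (s≤s z≤n)
  odd' : oddClosed (child M 3) ≡ o'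
  odd' = suc-injective (+-cancelˡ-≡ o _ (suc o') (begin
    o + suc (oddClosed (child M 3))                        ≡⟨ cong (o +_) (oddClosed-child₃ M (proj₁ stair) g1) ⟩
    o + oddCount (suc (length M)) (suc ∘ closedBy (edges M)) ≡⟨ cong (_+ _) (sym odd≡) ⟩
    oddClosed M + oddCount (suc (length M)) (suc ∘ closedBy (edges M)) ≡⟨ oddClosed+evenClosed (suc n) M∈ ⟩
    suc (2 * suc n)                                        ≡⟨ cong suc (sym sum≡) ⟩
    suc (o' + o)                                           ≡⟨ trans (cong suc (+-comm o' o)) (sym (+-suc o o')) ⟩
    o + suc o'                                             ∎))
    where open ≡-Reasoning

realised-3 : ∀ p q → p < 2 → q < 3 → Realised 3 p (⌈ 3 /2⌉ + q)
realised-3 0 0 _ _ = realisedBy {3} (3 ∷ 4 ∷ 1 ∷ 2 ∷ 6 ∷ 5 ∷ [])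
realised-3 0 1 _ _ = realisedBy {3} (2 ∷ 1 ∷ 4 ∷ 3 ∷ 6 ∷ 5 ∷ [])
realised-3 0 2 _ _ = realisedBy {3} (2 ∷ 1 ∷ 5 ∷ 6 ∷ 3 ∷ 4 ∷ [])
realised-3 1 0 _ _ = realisedBy {3} (4 ∷ 3 ∷ 2 ∷ 1 ∷ 6 ∷ 5 ∷ [])
realised-3 1 1 _ _ = realisedBy {3} (5 ∷ 3 ∷ 2 ∷ 6 ∷ 1 ∷ 4 ∷ [])
realised-3 1 2 _ _ = realisedBy {3} (2 ∷ 1 ∷ 6 ∷ 5 ∷ 4 ∷ 3 ∷ [])
realised-3 (suc (suc _)) _ (s≤s (s≤s ())) _
realised-3 _ (suc (suc (suc _))) _ (s≤s (s≤s (s≤s ())))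

⌈suc/2⌉+⌈/2⌉ : ∀ n → ⌈ suc n /2⌉ + ⌈ n /2⌉ ≡ suc n
⌈suc/2⌉+⌈/2⌉ n = cong suc (⌊n/2⌋+⌈n/2⌉≡n n)

-- The values 2n - o and 2n + 1 - o realised by the children {1,3} and {1,2}
-- of a matching with oddClosed = o fill the range one level up.
realised : ∀ m p q → p < 2 → q < 3 + m → Realised (3 + m) p (⌈ 3 + m /2⌉ + q)
realised zero    p q p<2 q<3 = realised-3 p q p<2 q<3
realised (suc m) p q' p<2 q'< with q' <? 3 + m
... | yes q'<n = realised-child₃ {n = 2 + m} (realised m p q p<2 q<n) (begin
  (c' + q') + (c + q)   ≡⟨ +-interchange c' q' c q ⟩
  (c' + c) + (q' + q)   ≡⟨ cong₂ _+_ (⌈suc/2⌉+⌈/2⌉ (3 + m)) q'+q≡ ⟩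
  (4 + m) + (2 + m)     ≡⟨ ℕ-solve 1 (λ m → (ℕ-con 4 ⊕ m) ⊕ (ℕ-con 2 ⊕ m) ⊜ ℕ-con 2 ⊛ (ℕ-con 3 ⊕ m)) refl m ⟩
  2 * (3 + m)           ∎)
  where
  open ≡-Reasoning
  c = ⌈ 3 + m /2⌉
  c' = ⌈ 4 + m /2⌉
  q = (2 + m) ∸ q'
  q'+q≡ : q' + q ≡ 2 + m
  q'+q≡ = m+[n∸m]≡n (≤-pred q'<n)
  q<n : q < 3 + m
  q<n = s≤s (m∸n≤m (2 + m) q')
... | no q'≮n = subst (λ z → Realised (4 + m) p (⌈ 4 + m /2⌉ + z)) (sym q'≡n) (realised-child₂ {n = 3 + m} (realised m p 0 p<2 z<s) (begin
  (c' + (3 + m)) + (c + 0)  ≡⟨ cong ((c' + (3 + m)) +_) (+-identityʳ c) ⟩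
  (c' + (3 + m)) + c        ≡⟨ ℕ-solve 3 (λ a b c → (a ⊕ b) ⊕ c ⊜ (a ⊕ c) ⊕ b) refl c' (3 + m) c ⟩
  (c' + c) + (3 + m)        ≡⟨ cong (_+ (3 + m)) (⌈suc/2⌉+⌈/2⌉ (3 + m)) ⟩
  (4 + m) + (3 + m)         ≡⟨ ℕ-solve 1 (λ m → (ℕ-con 4 ⊕ m) ⊕ (ℕ-con 3 ⊕ m) ⊜ ℕ-con 1 ⊕ ℕ-con 2 ⊛ (ℕ-con 3 ⊕ m)) refl m ⟩
  suc (2 * (3 + m))         ∎))
  where
  open ≡-Reasoning
  c = ⌈ 3 + m /2⌉
  c' = ⌈ 4 + m /2⌉
  q'≡n : q' ≡ 3 + m
  q'≡n = ≤-antisym (≤-pred q'<) (≮⇒≥ q'≮n)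

∼-refl : ∀ {s} M → M ∼[ s ] M
∼-refl M l = ↭-refl

numClasses-discrete : ∀ {s} n → AllPairs (λ M N → ¬ (M ∼[ s ] N)) (matchings n) → NumClasses s n (n !!)
numClasses-discrete n distinct = matchings n , length-matchings n , ∈-matchings⇒IsMatching n , distinct ,
  λ N isM → Any.map (λ { refl → ∼-refl N }) (IsMatching⇒∈-matchings n isM)

module _ {s : Matching → ℕ} {n : ℕ} {I K : Set} (κ : Matching → K) (key : I → K)
         (∼⇒κ≡ : ∀ {M N} → M ∈ matchings n → N ∈ matchings n → M ∼[ s ] N → κ M ≡ κ N)
         (κ≡⇒∼ : ∀ {M N} → M ∈ matchings n → N ∈ matchings n → κ M ≡ κ N → M ∼[ s ] N)
         (idx : List I) (idx-unique : Unique idx) (idx-complete : ∀ i → i ∈ idx)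
         (key-injective : ∀ {i j} → key i ≡ key j → i ≡ j)
         (rep : I → Matching) (rep-∈ : ∀ i → rep i ∈ matchings n) (κ-rep : ∀ i → κ (rep i) ≡ key i)
         (κ-covered : ∀ {N} → N ∈ matchings n → Σ I λ i → κ N ≡ key i) where

  numClasses-byInvariant : NumClasses s n (length idx)
  numClasses-byInvariant = map rep idx , length-map rep idx , isMatching , distinct , covered
    where
    isMatching : ∀ {M} → M ∈ map rep idx → IsMatching n M
    isMatching M∈ with ∈-map⁻ rep M∈
    ... | i , _ , refl = ∈-matchings⇒IsMatching n (rep-∈ i)
    distinct : AllPairs (λ M N → ¬ (M ∼[ s ] N)) (map rep idx)
    distinct = AllPairsᴾ.map⁺ (AllPairs.map (λ {i} {j} i≢j rep∼ →
      i≢j (key-injective (trans (sym (κ-rep i)) (trans (∼⇒κ≡ (rep-∈ i) (rep-∈ j) rep∼) (κ-rep j))))) idx-unique)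
    covered : ∀ N → IsMatching n N → Any (λ M → N ∼[ s ] M) (map rep idx)
    covered N isM = Any.map (λ { refl → κ≡⇒∼ N∈ (rep-∈ i) (trans κN≡ (sym (κ-rep i))) }) (∈-map⁺ rep (idx-complete i))
      where
      N∈ = IsMatching⇒∈-matchings n isM
      i = proj₁ (κ-covered N∈)
      κN≡ = proj₂ (κ-covered N∈)

cr₂-≡⇒∼ : ∀ {n M N} → M ∈ matchings n → N ∈ matchings n → cr₂ M ≡ cr₂ N → M ∼[ cr₂ ] N
cr₂-≡⇒∼ {n} M∈ N∈ = balanced-cr₂-≡⇒∼ (∈-matchings⇒Balanced n M∈) (∈-matchings⇒Balanced n N∈)
  (trans (length-∈-matchings n M∈) (sym (length-∈-matchings n N∈)))

cr-child₂ : ∀ v → cr (child v 2) ≡ cr v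
cr-child₂ v = trans (cr-child v 0) (trans (cong (cr v +_) (cut-zero v)) (+-identityʳ (cr v)))

crRealised : ∀ m (b : Fin 2) → Σ Matching λ M → M ∈ matchings (2 + m) × cr₂ M ≡ toℕ b
crRealised zero    Fin.zero           = 2 ∷ 1 ∷ 4 ∷ 3 ∷ [] , toWitness {a? = _ ∈? matchings 2} _ , refl
crRealised zero    (Fin.suc Fin.zero) = 3 ∷ 4 ∷ 1 ∷ 2 ∷ [] , toWitness {a? = _ ∈? matchings 2} _ , refl
crRealised (suc m) b with crRealised m b
... | M , M∈ , cr₂≡ = child M 2 , child-∈-matchings (2 + m) 0 M∈ z≤n , trans (cong (_% 2) (cr-child₂ M)) cr₂≡

crRep : ℕ → Fin 2 → Matching
crRep m b = proj₁ (crRealised m b)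

cr₂-covered : ∀ N → Σ (Fin 2) λ b → cr₂ N ≡ toℕ b
cr₂-covered N = fromℕ< (m%n<n (cr N) 2) , sym (toℕ-fromℕ< (m%n<n (cr N) 2))

numClasses-cr₂ : ∀ m → NumClasses cr₂ (2 + m) 2
numClasses-cr₂ m = numClasses-byInvariant {n = 2 + m} cr₂ toℕ (λ _ _ → ∼⇒≡ {cr₂}) (cr₂-≡⇒∼ {2 + m})
  (allFin 2) (Uniqueᴾ.allFin⁺ 2) ∈-allFin toℕ-injective
  (crRep m) (proj₁ ∘ proj₂ ∘ crRealised m) (proj₂ ∘ proj₂ ∘ crRealised m) (λ {N} _ → cr₂-covered N)

module _ (s : Matching → ℕ) where

  withParity : ℕ → List Matching → List Matching
  withParity b = filter (λ N → s N % 2 ≟ b)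

  parityCounts : ∀ L → length (withParity 0 L) + length (withParity 1 L) ≡ length L ×
    sumℤ (-1^_ ∘ s) L ≡ ℤ.+ length (withParity 0 L) ℤ.- ℤ.+ length (withParity 1 L)
  parityCounts [] = refl , refl
  parityCounts (N ∷ L) with parityCounts L | parity (s N)
  ... | l , z | even e σ
    rewrite filter-accept (λ N → s N % 2 ≟ 0) {N} {L} e | filter-reject (λ N → s N % 2 ≟ 1) {N} {L} (λ e' → 0≢1+n (trans (sym e) e')) | σ =
    cong suc l , trans (cong (ℤ._+_ 1ℤ) z) (solve 2 (λ a b → con 1ℤ :+ (a :- b) := (con 1ℤ :+ a) :- b) refl (ℤ.+ length (withParity 0 L)) (ℤ.+ length (withParity 1 L)))
  ... | l , z | odd e σ
    rewrite filter-reject (λ N → s N % 2 ≟ 0) {N} {L} (λ e' → 1+n≢0 (trans (sym e) e')) | filter-accept (λ N → s N % 2 ≟ 1) {N} {L} e | σ =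
    trans (+-suc _ _) (cong suc l) , trans (cong (ℤ._+_ -1ℤ) z) (solve 2 (λ a b → con -1ℤ :+ (a :- b) := a :- (con 1ℤ :+ b)) refl (ℤ.+ length (withParity 0 L)) (ℤ.+ length (withParity 1 L)))

classSize-cr₂ : ∀ n {M} b → M ∈ matchings n → cr₂ M ≡ b → ClassSize cr₂ n M (length (withParity cr b (matchings n)))
classSize-cr₂ n {M} b M∈ cr₂≡b =
  withParity cr b (matchings n) , Uniqueᴾ.filter⁺ (λ N → cr N % 2 ≟ b) (matchings-unique n) , refl , λ N → to , from
  where
  to : ∀ {N} → N ∈ withParity cr b (matchings n) → IsMatching n N × N ∼[ cr₂ ] M
  to N∈ with ∈-filter⁻ (λ N → cr N % 2 ≟ b) {xs = matchings n} N∈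
  ... | N∈' , cr₂≡ = ∈-matchings⇒IsMatching n N∈' , cr₂-≡⇒∼ {n} N∈' M∈ (trans cr₂≡ (sym cr₂≡b))
  from : ∀ {N} → IsMatching n N × N ∼[ cr₂ ] M → N ∈ withParity cr b (matchings n)
  from (isM , N∼M) = ∈-filter⁺ (λ N → cr N % 2 ≟ b) (IsMatching⇒∈-matchings n isM) (trans (∼⇒≡ N∼M) cr₂≡b)

-- The signed crossing sum over 𝓜(n) is 1, so even crossing parities exceed odd ones by one.
crParity-sizes : ∀ n → length (withParity cr 0 (matchings n)) ≡ ((n !!) + 1) / 2 ×
                       length (withParity cr 1 (matchings n)) ≡ ((n !!) ∸ 1) / 2
crParity-sizes n = half-even , half-odd
  where
  E = length (withParity cr 0 (matchings n))
  O = length (withParity cr 1 (matchings n))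
  counts = parityCounts cr (matchings n)
  E+O : E + O ≡ n !!
  E+O = trans (proj₁ counts) (length-matchings n)
  E-O : ℤ.+ E ℤ.- ℤ.+ O ≡ 1ℤ
  E-O = trans (sym (proj₂ counts)) (sumℤ-tree-cr n [] Balanced-[])
  E+E : E + E ≡ suc (n !!)
  E+E = ℤ.+-injective (begin
    ℤ.+ (E + E)                               ≡⟨ ℤ.pos-+ E E ⟩
    ℤ.+ E ℤ.+ ℤ.+ E                           ≡⟨ solve 2 (λ e o → e :+ e := (e :- o) :+ (e :+ o)) refl (ℤ.+ E) (ℤ.+ O) ⟩
    (ℤ.+ E ℤ.- ℤ.+ O) ℤ.+ (ℤ.+ E ℤ.+ ℤ.+ O)   ≡⟨ cong₂ ℤ._+_ E-O (trans (sym (ℤ.pos-+ E O)) (cong ℤ.+_ E+O)) ⟩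
    ℤ.+ suc (n !!)                            ∎)
    where open ≡-Reasoning
  E≡1+O : E ≡ suc O
  E≡1+O = +-cancelˡ-≡ E E (suc O) (trans E+E (sym (trans (+-suc E O) (cong suc E+O))))
  double/2 : ∀ a → (a + a) / 2 ≡ a
  double/2 a = trans (cong (_/ 2) (trans (cong (a +_) (sym (+-identityʳ a))) (*-comm 2 a))) (m*n/n≡m a 2)
  half-even : E ≡ ((n !!) + 1) / 2
  half-even = sym (trans (cong (_/ 2) (trans (+-comm (n !!) 1) (sym E+E))) (double/2 E))
  half-odd : O ≡ ((n !!) ∸ 1) / 2
  half-odd = sym (trans (cong (λ t → (t ∸ 1) / 2) (trans (sym E+O) (cong (_+ O) E≡1+O))) (double/2 O))

neKey : Matching → ℕ × ℕ
neKey M = ne₂ M , oddClosed M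

module _ {n M N} (M∈ : M ∈ matchings n) (N∈ : N ∈ matchings n) where

  private
    |M|≡|N| : length M ≡ length N
    |M|≡|N| = trans (length-∈-matchings n M∈) (sym (length-∈-matchings n N∈))

  ∼ne₂⇒neKey-≡ : M ∼[ ne₂ ] N → neKey M ≡ neKey N
  ∼ne₂⇒neKey-≡ M∼N =
    cong₂ _,_ (proj₁ (∼⇒ne₂-balance-≡ M∼N)) (nestingBalance-≡⇒oddClosed-≡ {M} {N} |M|≡|N| (proj₂ (∼⇒ne₂-balance-≡ M∼N)))

  neKey-≡⇒∼ne₂ : neKey M ≡ neKey N → M ∼[ ne₂ ] N
  neKey-≡⇒∼ne₂ key≡ = ne₂-balance-≡⇒∼ |M|≡|N| (cong proj₁ key≡) (oddClosed-≡⇒nestingBalance-≡ {M} {N} |M|≡|N| (cong proj₂ key≡))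

numClasses-ne₂-2 : NumClasses ne₂ 2 3
numClasses-ne₂-2 = numClasses-discrete 2
  ((distinct (here refl) (there (here refl)) (λ ()) ∷ distinct (here refl) (there (there (here refl))) (λ ()) ∷ []) ∷
   (distinct (there (here refl)) (there (there (here refl))) (λ ()) ∷ []) ∷ [] ∷ [])
  where
  distinct : ∀ {M N} → M ∈ matchings 2 → N ∈ matchings 2 → neKey M ≢ neKey N → ¬ (M ∼[ ne₂ ] N)
  distinct M∈ N∈ key≢ = key≢ ∘ ∼ne₂⇒neKey-≡ {2} M∈ N∈

length-cartesianProduct : ∀ {A B : Set} (xs : List A) (ys : List B) →
  length (cartesianProduct xs ys) ≡ length xs * length ys
length-cartesianProduct []       ys = refl
length-cartesianProduct (x ∷ xs) ys =
  trans (length-++ (map (x ,_) ys)) (cong₂ _+_ (length-map (x ,_) ys) (length-cartesianProduct xs ys))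

numClasses-ne₂ : ∀ m → NumClasses ne₂ (3 + m) (2 * (3 + m))
numClasses-ne₂ m = subst (NumClasses ne₂ n) size
  (numClasses-byInvariant {n = n} neKey key (∼ne₂⇒neKey-≡ {n}) (neKey-≡⇒∼ne₂ {n})
    idx (Uniqueᴾ.cartesianProduct⁺ (Uniqueᴾ.allFin⁺ 2) (Uniqueᴾ.allFin⁺ n))
    (λ (p , q) → ∈-cartesianProduct⁺ (∈-allFin p) (∈-allFin q)) key-injective
    rep (proj₁ ∘ proj₂ ∘ realisation) (λ i → cong₂ _,_ (proj₁ (proj₂ (proj₂ (realisation i)))) (proj₂ (proj₂ (proj₂ (realisation i)))))
    covered)
  where
  n = 3 + m
  c = ⌈ n /2⌉
  key : Fin 2 × Fin n → ℕ × ℕ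
  key (p , q) = toℕ p , c + toℕ q
  idx = cartesianProduct (allFin 2) (allFin n)
  size : length idx ≡ 2 * n
  size = trans (length-cartesianProduct (allFin 2) (allFin n)) (cong (2 *_) (length-tabulate {n = n} id))
  key-injective : ∀ {i j} → key i ≡ key j → i ≡ j
  key-injective key≡ = cong₂ _,_ (toℕ-injective (cong proj₁ key≡)) (toℕ-injective (+-cancelˡ-≡ c _ _ (cong proj₂ key≡)))
  realisation : (i : Fin 2 × Fin n) → Realised n (toℕ (proj₁ i)) (c + toℕ (proj₂ i))
  realisation (p , q) = realised m (toℕ p) (toℕ q) (toℕ<n p) (toℕ<n q)
  rep = proj₁ ∘ realisation
  covered : ∀ {N} → N ∈ matchings n → Σ (Fin 2 × Fin n) λ i → neKey N ≡ key i
  covered {N} N∈ = (fromℕ< (m%n<n (ne N) 2) , fromℕ< q<n) ,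
    cong₂ _,_ (sym (toℕ-fromℕ< _)) (trans (sym (m+[n∸m]≡n c≤o)) (cong (c +_) (sym (toℕ-fromℕ< q<n))))
    where
    range = oddClosed-range (2 + m) N∈
    c≤o = proj₁ range
    q<n : oddClosed N ∸ c < n
    q<n = +-cancelˡ-< c (oddClosed N ∸ c) n (subst (_< c + n) (sym (m+[n∸m]≡n c≤o)) (proj₂ range))

cr₂-twoClasses : ∀ m → let n = 2 + m in
  NumClasses cr₂ n 2 ×
  Σ Matching (λ M₁ → Σ Matching (λ M₂ →
    IsMatching n M₁ × IsMatching n M₂ × ¬ (M₁ ∼[ cr₂ ] M₂) ×
    ClassSize cr₂ n M₁ (((n !!) + 1) / 2) ×
    ClassSize cr₂ n M₂ (((n !!) ∸ 1) / 2)))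
cr₂-twoClasses m with crRealised m Fin.zero | crRealised m (Fin.suc Fin.zero)
... | M₁ , M₁∈ , cr₂≡0 | M₂ , M₂∈ , cr₂≡1 =
  numClasses-cr₂ m , M₁ , M₂ ,
  ∈-matchings⇒IsMatching (2 + m) M₁∈ , ∈-matchings⇒IsMatching (2 + m) M₂∈ ,
  (λ M₁∼M₂ → 0≢1+n (trans (sym cr₂≡0) (trans (∼⇒≡ M₁∼M₂) cr₂≡1))) ,
  subst (ClassSize cr₂ (2 + m) M₁) (proj₁ (crParity-sizes (2 + m))) (classSize-cr₂ (2 + m) 0 M₁∈ cr₂≡0) ,
  subst (ClassSize cr₂ (2 + m) M₂) (proj₂ (crParity-sizes (2 + m))) (classSize-cr₂ (2 + m) 1 M₂∈ cr₂≡1)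

theorem4p4 :
    NumClasses cr₂ 1 1 ×
    (∀ n → 2 ≤ n →
       NumClasses cr₂ n 2 ×
       Σ Matching (λ M₁ → Σ Matching (λ M₂ →
         IsMatching n M₁ × IsMatching n M₂ × ¬ (M₁ ∼[ cr₂ ] M₂) ×
         ClassSize cr₂ n M₁ (((n !!) + 1) / 2) ×
         ClassSize cr₂ n M₂ (((n !!) ∸ 1) / 2)))) ×
    NumClasses ne₂ 1 1 ×
    NumClasses ne₂ 2 3 ×
    (∀ n → 3 ≤ n → NumClasses ne₂ n (2 * n))
theorem4p4 =
  numClasses-discrete 1 ([] ∷ []) ,
  (λ { (suc (suc m)) _ → cr₂-twoClasses m ; (suc zero) (s≤s ()) }) ,
  numClasses-discrete 1 ([] ∷ []) ,
  numClasses-ne₂-2 ,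
  λ { (suc (suc (suc m))) _ → numClasses-ne₂ m ; (suc zero) (s≤s ()) ; (suc (suc zero)) (s≤s (s≤s ())) }
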